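{- Let $k\geq 4$ and let $\tau=\tau_1\cdots\tau_{k-2}21\in S_k$ be a pattern whose last two letters are $2$ and $1$ (i.e. $\tau_{k-1}=2$ and $\tau_k=1$). Then for every integer $n\geq 2$, $$a_n(\tau,4321;213)=a_n(\tau^{ -1},4321;312)=F_{2n-3},$$ where $\tau^{ -1}$ is the inverse permutation of $\tau$ and $F_m$ is the $m$-th Fibonacci number.
   Context: A permutation $\pi$ of $[n]=\{1,\dots,n\}$ is cyclic if it consists of a single $n$-cycle. Its one-line notation is $\pi_1\pi_2\cdots\pi_n$ with $\pi_i=\pi(i)$. Its standard cycle form is $(c_1,c_2,\dots,c_n)$ with $c_1=1$ and $c_{i+1}=\pi(c_i)$ for $1\le i<n$ (the cycle written starting at $1$). A sequence $w_1\cdots w_n$ of distinct integers contains a pattern $\sigma=\sigma_1\cdots\sigma_k\in S_k$ if there are indices $i_1<\dots<i_k$ with $w_{i_s}>w_{i_t}$ iff $\sigma_s>\sigma_t$ for all $1\le s<t\le k$; otherwise it avoids $\sigma$. For patterns $\sigma_1,\dots,\sigma_l,\rho$, $\mathcal{A}_n(\sigma_1,\dots,\sigma_l;\rho)$ is the set of cyclic permutations of $[n]$ whose one-line notation avoids each $\sigma_i$ and whose standard cycle form $c_1c_2\cdots c_n$, read as a sequence, avoids $\rho$; and $a_n(\sigma_1,\dots,\sigma_l;\rho)=|\mathcal{A}_n(\sigma_1,\dots,\sigma_l;\rho)|$. Fibonacci numbers: $F_0=0$, $F_1=1$, $F_m=F_{m-1}+F_{m-2}$ for $m\ge 2$. 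-}

module Defs where

open import Data.Nat using (ℕ; zero; suc; _+_; _<_; _≟_)
open import Data.List using (List; []; _∷_; map; length; upTo)
open import Data.List.Relation.Binary.Permutation.Propositional using (_↭_)
open import Data.List.Relation.Binary.Sublist.Propositional using (_⊆_)
open import Data.List.Relation.Unary.Unique.Propositional using (Unique)
open import Data.List.Relation.Unary.All using (All)
open import Data.List.Membership.Propositional using (_∈_)
open import Data.Product using (Σ; ∃; _×_)
open import Function.Bundles using (_⇔_)
open import Relation.Binary.PropositionalEquality using (_≡_)
open import Relation.Nullary using (¬_; yes; no)

F : ℕ → ℕ
F zero = 0
F (suc zero) = 1
F (suc (suc m)) = F (suc m) + F m

oneTo : ℕ → List ℕ
oneTo n = map suc (upTo n)

-- a sequence (one-line notation) is a permutation of [n]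
IsPerm : ℕ → List ℕ → Set
IsPerm n w = w ↭ oneTo n

-- 0-indexed entry of a list (default 0 out of range)
at : List ℕ → ℕ → ℕ
at []      _       = 0
at (x ∷ _) zero    = x
at (_ ∷ w) (suc i) = at w i

app : List ℕ → ℕ → ℕ
app w i = at w (i Data.Nat.∸ 1)

orbitFrom : List ℕ → ℕ → ℕ → List ℕ
orbitFrom w zero    c = []
orbitFrom w (suc m) c = c ∷ orbitFrom w m (app w c)

-- standard cycle form (c_1, …, c_n), read as a sequence
cycleForm : ℕ → List ℕ → List ℕ
cycleForm n w = orbitFrom w n 1

-- π (a permutation of [n]) is cyclic: a single n-cycle, i.e. the orbit of 1
-- has n distinct elements
Cyclic : ℕ → List ℕ → Set
Cyclic n w = Unique (cycleForm n w)

OrderIso : List ℕ → List ℕ → Set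
OrderIso u σ = (length u ≡ length σ) ×
  (∀ s t → s < t → t < length σ → ((at u t < at u s) ⇔ (at σ t < at σ s)))

Contains : List ℕ → List ℕ → Set
Contains w σ = ∃ λ u → (u ⊆ w) × OrderIso u σ

Avoids : List ℕ → List ℕ → Set
Avoids w σ = ¬ Contains w σ

-- position (1-based) of j in w; 0 if absent
posOf : ℕ → List ℕ → ℕ
posOf j [] = 0
posOf j (x ∷ w) with j ≟ x
... | yes _ = 1
... | no  _ = suc (posOf j w)

inverse : ℕ → List ℕ → List ℕ
inverse k τ = map (λ j → posOf j τ) (oneTo k)

InA : ℕ → List (List ℕ) → List ℕ → List ℕ → Set
InA n σs ρ w = IsPerm n w × Cyclic n w × All (Avoids w) σs × Avoids (cycleForm n w) ρ

HasCard : (List ℕ → Set) → ℕ → Set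
HasCard P m = Σ (List (List ℕ)) λ L → Unique L × (∀ w → (w ∈ L) ⇔ P w) × (length L ≡ m)

-- The cycle form 1 ∷ s of a cyclic permutation π determines π through its arcs x ↦ π x, the
-- consecutive pairs of 1 ∷ s closed up by (last, 1); an occurrence of a pattern in π is a set of arcs
-- with increasing sources whose targets form the pattern. As τ ends with 21 after two entries ≥ 3, an
-- occurrence of τ or of 4321 yields arcs whose targets form 3421 or 4321 (shape Ends21); an occurrence
-- of τ⁻¹ yields 4312 or 4321, which is Ends21 for π⁻¹, whose cycle form is 1 ∷ reverse s.
--
-- The cycle forms generated from 1 by s ↦ 2 ∷ (s + 1) and t ↦ (t + e + 1) ++ (2, 3, …, e + 2) avoid 213,
-- and their arcs avoid even Ends21. Conversely, avoiding 213 and 4321 forces one of these shapes: with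
-- s = α ++ 2 ∷ β, a 213 (x, 2, y) shows β < α, and a peak in 2 ∷ β gives a 4321 among the arcs, so β is
-- the increasing run 3, …, e + 2. Hence both classes are this family, and counting the two steps gives
-- aₙ₊₁ = aₙ + bₙ₊₁ and bₙ₊₁ = aₙ + bₙ, where bₙ counts the second step: aₙ = F (2n − 3).

module Submission where

open import Defs
open import Data.Empty using (⊥; ⊥-elim)
open import Data.Nat
  using (ℕ; zero; suc; pred; _+_; _*_; _∸_; _≤_; _<_; _≟_; _<?_; _≤?_; z≤n; s≤s; z<s; s<s; >-nonZero)
open import Data.Nat.Induction using (<-rec)
open import Data.Nat.Properties
open import Data.Nat.Tactic.RingSolver using (solve-∀)
open import Data.List using (List; []; _∷_; _++_; map; length; reverse; [_]; applyUpTo)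
open import Data.List.Properties
  using (length-map; length-++; length-reverse; ++-assoc; ∷-injectiveˡ; ∷-injectiveʳ; map-∘; map-id;
         map-injective; map-applyUpTo; map-cong-local; reverse-++; unfold-reverse; reverse-involutive;
         reverse-selfInverse; reverse-injective)
open import Data.List.Membership.Propositional using (_∈_; _∉_)
open import Data.List.Membership.Propositional.Properties using (∈-map⁺; ∈-map⁻; ∈-++⁺ˡ; ∈-++⁺ʳ; ∈-++⁻; ∈-∃++)
open import Data.List.Membership.Propositional.Properties.WithK using (unique∧set⇒bag)
open import Data.List.Membership.DecPropositional _≟_ using (_∈?_)
open import Data.List.Relation.Unary.Any using (here; there)
open import Data.List.Relation.Unary.All as All using (All; []; _∷_)
open import Data.List.Relation.Unary.All.Properties using () renaming (map⁺ to All-map⁺; ++⁺ to All-++⁺)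
open import Data.List.Relation.Unary.AllPairs as AllPairs using (AllPairs; []; _∷_)
open import Data.List.Relation.Unary.Linked using ([]; [-]; _∷_)
open import Data.List.Relation.Unary.Linked.Properties using (Linked⇒AllPairs; AllPairs⇒Linked)
open import Data.List.Relation.Unary.Unique.Propositional using (Unique)
import Data.List.Relation.Unary.Unique.Propositional.Properties as Unique
open import Data.List.Relation.Binary.Sublist.Propositional
  using (_⊆_; []; _∷_; _∷ʳ_; ⊆-refl; ⊆-trans; minimum; from∈)
import Data.List.Relation.Binary.Sublist.Propositional.Properties as Sublist
open import Data.List.Relation.Binary.Permutation.Propositional using (_↭_; ↭-sym; ↭-prep; ↭⇒↭ₛ)
open import Data.List.Relation.Binary.Permutation.Propositional.Properties
  using (∈-resp-↭; ↭-length; ++-comm; ↭-reverse)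
open import Data.List.Relation.Binary.BagAndSetEquality using (∼bag⇒↭)
open import Data.Product using (∃; ∃₂; _×_; _,_; proj₁; proj₂)
import Data.Product as Product
open import Data.Sum using (_⊎_; inj₁; inj₂)
open import Function.Base using (_∘_)
open import Function.Bundles using (_⇔_; mk⇔; Equivalence)
open import Relation.Binary.Definitions using (Tri; tri<; tri≈; tri>)
open import Relation.Binary.PropositionalEquality
  using (_≡_; _≢_; refl; sym; trans; cong; cong₂; subst; subst₂; setoid; module ≡-Reasoning)
open import Relation.Nullary using (¬_; yes; no)
open import Relation.Nullary.Decidable using (True; toWitness; from-yes; from-no)
open import Data.List.Relation.Binary.Permutation.Setoid.Properties (setoid ℕ) using (Unique-resp-↭)

AllPairs-⊆ : ∀ {R : ℕ → ℕ → Set} {u w} → u ⊆ w → AllPairs R w → AllPairs R u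
AllPairs-⊆ []         []         = []
AllPairs-⊆ (_ ∷ʳ u⊆)  (_ ∷ w↑)   = AllPairs-⊆ u⊆ w↑
AllPairs-⊆ (refl ∷ u⊆) (x~ ∷ w↑) = Sublist.All-resp-⊆ u⊆ x~ ∷ AllPairs-⊆ u⊆ w↑

InjectiveOn : {A B : Set} → (A → B) → List A → Set
InjectiveOn f xs = ∀ {x y} → x ∈ xs → y ∈ xs → f x ≡ f y → x ≡ y

unique-map⁺ : {A B : Set} {f : A → B} {xs : List A} → InjectiveOn f xs → Unique xs → Unique (map f xs)
unique-map⁺         {xs = []}     _     []          = []
unique-map⁺ {f = f} {xs = x ∷ xs} f-inj (x∉ ∷ xs!) =
  All.tabulate fx∉ ∷ unique-map⁺ (λ x∈ y∈ → f-inj (there x∈) (there y∈)) xs!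
  where
  fx∉ : ∀ {y} → y ∈ map f xs → f x ≢ y
  fx∉ y∈ fx≡y with z , z∈ , refl ← ∈-map⁻ f y∈ = All.lookup x∉ z∈ (f-inj (here refl) (there z∈) fx≡y)

unique-map⁻ : {A B : Set} (f : A → B) {xs : List A} → Unique (map f xs) → InjectiveOn f xs
unique-map⁻ f {x ∷ xs} _           (here refl) (here refl) _    = refl
unique-map⁻ f {x ∷ xs} (fx∉ ∷ _)   (here refl) (there y∈)  fx≡fy = ⊥-elim (All.lookup fx∉ (∈-map⁺ f y∈) fx≡fy)
unique-map⁻ f {x ∷ xs} (fx∉ ∷ _)   (there x∈)  (here refl) fx≡fy = ⊥-elim (All.lookup fx∉ (∈-map⁺ f x∈) (sym fx≡fy))
unique-map⁻ f {x ∷ xs} (_ ∷ fxs!)  (there x∈)  (there y∈)  fx≡fy = unique-map⁻ f fxs! x∈ y∈ fx≡fy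

unique-mid : ∀ (X : List ℕ) {x Y} → Unique (X ++ x ∷ Y) → x ∉ Y
unique-mid []      (x∉ ∷ _) x∈ = All.lookup x∉ x∈ refl
unique-mid (_ ∷ X) (_ ∷ X!)    = unique-mid X X!

unique-++ : ∀ (X : List ℕ) {Y x} → Unique (X ++ Y) → x ∈ Y → x ∉ X
unique-++ (a ∷ X) (a∉ ∷ _)  x∈Y (here refl) = All.lookup a∉ (∈-++⁺ʳ X x∈Y) refl
unique-++ (a ∷ X) (_ ∷ XY!) x∈Y (there x∈X) = unique-++ X XY! x∈Y x∈X

∈-remove : ∀ (A B : List ℕ) {x y} → y ∈ A ++ x ∷ B → y ≢ x → y ∈ A ++ B
∈-remove []      B (here refl) y≢x = ⊥-elim (y≢x refl)
∈-remove []      B (there y∈)  _   = y∈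
∈-remove (a ∷ A) B (here refl) _   = here refl
∈-remove (a ∷ A) B (there y∈)  y≢x = there (∈-remove A B y∈ y≢x)

length-mid : ∀ (A B : List ℕ) x → length (A ++ x ∷ B) ≡ suc (length (A ++ B))
length-mid []      B x = refl
length-mid (a ∷ A) B x = cong suc (length-mid A B x)

unique-length-≤ : ∀ {xs ys : List ℕ} → Unique xs → (∀ {x} → x ∈ xs → x ∈ ys) → length xs ≤ length ys
unique-length-≤ {[]}     _          _  = z≤n
unique-length-≤ {x ∷ xs} (x∉ ∷ xs!) xs⊆ with A , B , refl ← ∈-∃++ (xs⊆ (here refl)) =
  subst (suc (length xs) ≤_) (sym (length-mid A B x))
    (s≤s (unique-length-≤ xs! (λ y∈ → ∈-remove A B (xs⊆ (there y∈)) (λ { refl → All.lookup x∉ y∈ refl }))))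

split-before : ∀ h {x} L → x ∈ L → ∃₂ λ (A : List ℕ) p → ∃ λ B → h ∷ L ≡ A ++ p ∷ x ∷ B
split-before h (y ∷ L) (here refl) = [] , h , L , refl
split-before h (y ∷ L) (there x∈) with A , p , B , eq ← split-before y L x∈ = h ∷ A , p , B , cong (h ∷_) eq

last-∈ : ∀ (X : List ℕ) {y Y} A {l} → X ++ y ∷ Y ≡ A ++ [ l ] → l ∈ y ∷ Y
last-∈ []      A {l}   eq = subst (l ∈_) (sym eq) (∈-++⁺ʳ A (here refl))
last-∈ (x ∷ X) []      eq = ⊥-elim (nonempty X (∷-injectiveʳ eq))
  where
  nonempty : ∀ (X : List ℕ) {y Y} → X ++ y ∷ Y ≢ []
  nonempty []      ()
  nonempty (_ ∷ _) ()
last-∈ (x ∷ X) (a ∷ A) eq = last-∈ X A (∷-injectiveʳ eq)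

init-last : ∀ (a : ℕ) α → ∃₂ λ P l → a ∷ α ≡ P ++ [ l ]
init-last a []      = [] , a , refl
init-last a (b ∷ α) with P , l , eq ← init-last b α = a ∷ P , l , cong (a ∷_) eq

∈-after : ∀ {h : ℕ} {L} A {p R z} → h ∷ L ≡ A ++ p ∷ R → z ∈ R → z ∈ L
∈-after []      refl z∈ = z∈
∈-after (a ∷ A) {z = z} eq z∈ = subst (z ∈_) (sym (∷-injectiveʳ eq)) (∈-++⁺ʳ A (there z∈))

++-∷-cancel : ∀ (A A′ : List ℕ) {x B B′} → x ∉ A → x ∉ A′ → A ++ x ∷ B ≡ A′ ++ x ∷ B′ → A ≡ A′ × B ≡ B′
++-∷-cancel []      []       _    _     eq = refl , ∷-injectiveʳ eq
++-∷-cancel []      (a′ ∷ _) _    x∉A′ eq = ⊥-elim (x∉A′ (here (∷-injectiveˡ eq)))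
++-∷-cancel (a ∷ _) []       x∉A  _    eq = ⊥-elim (x∉A (here (sym (∷-injectiveˡ eq))))
++-∷-cancel (a ∷ A) (a′ ∷ A′) x∉A x∉A′ eq
  with A≡ , B≡ ← ++-∷-cancel A A′ (x∉A ∘ there) (x∉A′ ∘ there) (∷-injectiveʳ eq) =
  cong₂ _∷_ (∷-injectiveˡ eq) A≡ , B≡

⊆-map⁻ : ∀ (f : ℕ → ℕ) {u} xs → u ⊆ map f xs → ∃ λ v → u ≡ map f v × v ⊆ xs
⊆-map⁻ f []       []         = [] , refl , []
⊆-map⁻ f (x ∷ xs) (_ ∷ʳ u⊆) with v , refl , v⊆ ← ⊆-map⁻ f xs u⊆ = v , refl , x ∷ʳ v⊆
⊆-map⁻ f (x ∷ xs) (refl ∷ u⊆) with v , refl , v⊆ ← ⊆-map⁻ f xs u⊆ = x ∷ v , refl , refl ∷ v⊆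

⊆-++⁻ : ∀ {u : List ℕ} A {B} → u ⊆ A ++ B → ∃₂ λ u₁ u₂ → u ≡ u₁ ++ u₂ × u₁ ⊆ A × u₂ ⊆ B
⊆-++⁻ []      u⊆ = [] , _ , refl , [] , u⊆
⊆-++⁻ (a ∷ A) (_ ∷ʳ u⊆) with u₁ , u₂ , refl , u₁⊆ , u₂⊆ ← ⊆-++⁻ A u⊆ = u₁ , u₂ , refl , a ∷ʳ u₁⊆ , u₂⊆
⊆-++⁻ (a ∷ A) (refl ∷ u⊆) with u₁ , u₂ , refl , u₁⊆ , u₂⊆ ← ⊆-++⁻ A u⊆ = a ∷ u₁ , u₂ , refl , refl ∷ u₁⊆ , u₂⊆

at-∈ : ∀ L i → i < length L → at L i ∈ L
at-∈ (y ∷ L) zero    _         = here refl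
at-∈ (y ∷ L) (suc i) (s≤s i<n) = there (at-∈ L i i<n)

at-injective : ∀ L {i j} → Unique L → i < length L → j < length L → at L i ≡ at L j → i ≡ j
at-injective (x ∷ L) {zero}  {zero}  _        _        _        _  = refl
at-injective (x ∷ L) {zero}  {suc j} (x∉ ∷ _) _        (s≤s j<) eq = ⊥-elim (All.lookup x∉ (at-∈ L j j<) eq)
at-injective (x ∷ L) {suc i} {zero}  (x∉ ∷ _) (s≤s i<) _        eq = ⊥-elim (All.lookup x∉ (at-∈ L i i<) (sym eq))
at-injective (x ∷ L) {suc i} {suc j} (_ ∷ L!) (s≤s i<) (s≤s j<) eq = cong suc (at-injective L L! i< j< eq)

at-map : ∀ (f : ℕ → ℕ) xs i → i < length xs → at (map f xs) i ≡ f (at xs i)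
at-map f (x ∷ xs) zero    _         = refl
at-map f (x ∷ xs) (suc i) (s≤s i<n) = at-map f xs i i<n

at-++ : ∀ (A : List ℕ) B i → at (A ++ B) (length A + i) ≡ at B i
at-++ []      B i = refl
at-++ (_ ∷ A) B i = at-++ A B i

ascending-or-peak : ∀ p y L → p < y → AllPairs _<_ (p ∷ y ∷ L) ⊎
  ∃₂ λ A p′ → ∃₂ λ y′ x → ∃ λ Q → p ∷ y ∷ L ≡ A ++ p′ ∷ y′ ∷ x ∷ Q × p′ < y′ × x ≤ y′
ascending-or-peak p y []      p<y = inj₁ (Linked⇒AllPairs <-trans (p<y ∷ [-]))
ascending-or-peak p y (x ∷ L) p<y with y <? x
... | no  y≮x = inj₂ ([] , p , y , x , L , refl , p<y , ≮⇒≥ y≮x)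
... | yes y<x with ascending-or-peak y x L y<x
...   | inj₁ ascending = inj₁ (Linked⇒AllPairs <-trans (p<y ∷ AllPairs⇒Linked ascending))
...   | inj₂ (A , p′ , y′ , x′ , Q , eq , peak) = inj₂ (p ∷ A , p′ , y′ , x′ , Q , cong (p ∷_) eq , peak)

peak-free⇒ascending : ∀ {p} L → All (p <_) L →
  (∀ A {p′ y′ x} Q → p ∷ L ≡ A ++ p′ ∷ y′ ∷ x ∷ Q → p′ < y′ → x ≤ y′ → ⊥) → AllPairs _<_ L
peak-free⇒ascending []      _           _       = []
peak-free⇒ascending {p} (y ∷ L) (p<y ∷ _) no-peak with ascending-or-peak p y L p<y
... | inj₁ (_ ∷ L↑) = L↑
... | inj₂ (A , _ , _ , _ , Q , eq , p′<y′ , x≤y′) = ⊥-elim (no-peak A Q eq p′<y′ x≤y′)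

range : ℕ → ℕ → List ℕ
range a zero    = []
range a (suc n) = a ∷ range (suc a) n

InInterval : ℕ → ℕ → ℕ → Set
InInterval a n x = a ≤ x × x < a + n

InInterval-0 : ∀ {a x} → ¬ InInterval a 0 x
InInterval-0 {a} {x} (a≤x , x<a+0) = <⇒≱ (subst (x <_) (+-identityʳ a) x<a+0) a≤x

∈-range⁻ : ∀ {a n x} → x ∈ range a n → InInterval a n x
∈-range⁻ {a} {suc n} (here refl) = ≤-refl , m<m+n a z<s
∈-range⁻ {a} {suc n} {x} (there x∈) with a≤x , x<a+n ← ∈-range⁻ x∈ =
  <⇒≤ a≤x , subst (x <_) (sym (+-suc a n)) x<a+n

∈-range⁺ : ∀ {a n x} → InInterval a n x → x ∈ range a n
∈-range⁺ {a} {zero}  x∈ = ⊥-elim (InInterval-0 x∈)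
∈-range⁺ {a} {suc n} {x} (a≤x , x<a+1+n) with a ≟ x
... | yes refl = here refl
... | no a≢x   = there (∈-range⁺ (≤∧≢⇒< a≤x a≢x , subst (x <_) (+-suc a n) x<a+1+n))

length-range : ∀ a n → length (range a n) ≡ n
length-range a zero    = refl
length-range a (suc n) = cong suc (length-range (suc a) n)

range-increasing : ∀ a n → AllPairs _<_ (range a n)
range-increasing a zero    = []
range-increasing a (suc n) =
  All.tabulate (λ x∈ → proj₁ (∈-range⁻ x∈)) ∷ range-increasing (suc a) n

unique-range : ∀ a n → Unique (range a n)
unique-range a n = AllPairs.map <⇒≢ (range-increasing a n)

applyUpTo-range : ∀ (f : ℕ → ℕ) n → (∀ i → f (suc i) ≡ suc (f i)) → applyUpTo f n ≡ range (f 0) n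
applyUpTo-range f zero    _     = refl
applyUpTo-range f (suc n) f-suc = cong (f 0 ∷_)
  (trans (applyUpTo-range (λ i → f (suc i)) n (λ i → f-suc (suc i))) (cong (λ a → range a n) (f-suc 0)))

oneTo≡range : ∀ n → oneTo n ≡ range 1 n
oneTo≡range n = trans (map-applyUpTo (λ i → i) suc n) (applyUpTo-range suc n (λ _ → refl))

length-oneTo : ∀ n → length (oneTo n) ≡ n
length-oneTo n = trans (cong length (oneTo≡range n)) (length-range 1 n)

∈-oneTo⁻ : ∀ {n x} → x ∈ oneTo n → InInterval 1 n x
∈-oneTo⁻ {n} {x} x∈ = ∈-range⁻ (subst (x ∈_) (oneTo≡range n) x∈)

∈-oneTo⁺ : ∀ {n x} → InInterval 1 n x → x ∈ oneTo n
∈-oneTo⁺ {n} {x} x∈ = subst (x ∈_) (sym (oneTo≡range n)) (∈-range⁺ x∈)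

oneTo-increasing : ∀ n → AllPairs _<_ (oneTo n)
oneTo-increasing n = subst (AllPairs _<_) (sym (oneTo≡range n)) (range-increasing 1 n)

unique-oneTo : ∀ n → Unique (oneTo n)
unique-oneTo n = AllPairs.map <⇒≢ (oneTo-increasing n)

at-range : ∀ a n i → i < n → at (range a n) i ≡ a + i
at-range a (suc n) zero    _         = sym (+-identityʳ a)
at-range a (suc n) (suc i) (s≤s i<n) = trans (at-range (suc a) n i i<n) (sym (+-suc a i))

map-at-range : ∀ a u → map (λ i → at u (i ∸ a)) (range a (length u)) ≡ u
map-at-range a []      = refl
map-at-range a (y ∷ u) = cong₂ _∷_ (cong (at (y ∷ u)) (n∸n≡0 a))
  (trans (map-cong-local (All.tabulate shift)) (map-at-range (suc a) u))
  where
  shift : ∀ {i} → i ∈ range (suc a) (length u) → at (y ∷ u) (i ∸ a) ≡ at u (i ∸ suc a)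
  shift i∈ = cong (at (y ∷ u)) (+-∸-assoc 1 (proj₁ (∈-range⁻ i∈)))

InInterval-suc : ∀ {a n y} → a < y → InInterval a (suc n) y → InInterval (suc a) n y
InInterval-suc {a} {n} {y} a<y (_ , y<) = a<y , subst (y <_) (+-suc a n) y<

increasing-⊆-range : ∀ {a n xs} → AllPairs _<_ xs → All (InInterval a n) xs → xs ⊆ range a n
increasing-⊆-range {xs = []} _ _ = minimum _
increasing-⊆-range {a} {zero} {x ∷ xs} _ (x∈ ∷ _) = ⊥-elim (InInterval-0 x∈)
increasing-⊆-range {a} {suc n} {x ∷ xs} (x<xs ∷ xs↑) (x∈ ∷ xs∈) with a ≟ x
... | yes refl = refl ∷ increasing-⊆-range xs↑ (All.zipWith (λ (a<y , y∈) → InInterval-suc a<y y∈) (x<xs , xs∈))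
... | no a≢x   = a ∷ʳ increasing-⊆-range (x<xs ∷ xs↑)
  (InInterval-suc a<x x∈ ∷ All.zipWith (λ (x<y , y∈) → InInterval-suc (<-trans a<x x<y) y∈) (x<xs , xs∈))
  where a<x = ≤∧≢⇒< (proj₁ x∈) a≢x

subsequence-at : ∀ a u {is} → AllPairs _<_ is → All (InInterval a (length u)) is →
                 map (λ i → at u (i ∸ a)) is ⊆ u
subsequence-at a u {is} is↑ is∈ =
  subst (map (λ i → at u (i ∸ a)) is ⊆_) (map-at-range a u) (Sublist.map⁺ _ (increasing-⊆-range is↑ is∈))

ascending-closed⇒range : ∀ a L → AllPairs _<_ L → All (a ≤_) L →
  (∀ {y z} → y ∈ L → a ≤ z → z < y → z ∈ L) → L ≡ range a (length L)
ascending-closed⇒range a []      _          _          _      = refl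
ascending-closed⇒range a (h ∷ L) (h<L ∷ L↑) (a≤h ∷ a≤L) closed with a ≟ h
... | yes refl = cong (a ∷_) (ascending-closed⇒range (suc a) L L↑ h<L closed′)
  where
  closed′ : ∀ {y z} → y ∈ L → suc a ≤ z → z < y → z ∈ L
  closed′ y∈ a<z z<y with closed (there y∈) (<⇒≤ a<z) z<y
  ... | here refl = ⊥-elim (<-irrefl refl a<z)
  ... | there z∈  = z∈
... | no  a≢h with closed (here refl) ≤-refl (≤∧≢⇒< a≤h a≢h)
...   | here a≡h  = ⊥-elim (a≢h a≡h)
...   | there a∈L = ⊥-elim (<-irrefl refl (≤-<-trans a≤h (All.lookup h<L a∈L)))

app-map-oneTo : ∀ n f {x} → InInterval 1 n x → app (map f (oneTo n)) x ≡ f x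
app-map-oneTo n f {suc x} (_ , s≤s x<n) = begin
  at (map f (oneTo n)) x ≡⟨ at-map f (oneTo n) x (subst (x <_) (sym (length-oneTo n)) x<n) ⟩
  f (at (oneTo n) x)     ≡⟨ cong (λ L → f (at L x)) (oneTo≡range n) ⟩
  f (at (range 1 n) x)   ≡⟨ cong f (at-range 1 n x x<n) ⟩
  f (suc x)              ∎
  where open ≡-Reasoning

record PermOf (n : ℕ) (c : List ℕ) : Set where
  constructor perm
  field
    unique  : Unique c
    bounded : All (InInterval 1 n) c
    length≡ : length c ≡ n

cover : ∀ {n c x} → PermOf n c → InInterval 1 n x → x ∈ c
cover {n} {c} {x} (perm c! c⊆ |c|) x∈ with x ∈? c
... | yes x∈c = x∈c
... | no  x∉c with A , B , range≡ ← ∈-∃++ (∈-range⁺ x∈) = ⊥-elim (<-irrefl refl (begin-strict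
  n                   ≡⟨ sym |c| ⟩
  length c            ≤⟨ unique-length-≤ c! c⊆A++B ⟩
  length (A ++ B)     <⟨ n<1+n _ ⟩
  suc (length (A ++ B)) ≡⟨ sym (length-mid A B x) ⟩
  length (A ++ x ∷ B) ≡⟨ cong length (sym range≡) ⟩
  length (range 1 n)  ≡⟨ length-range 1 n ⟩
  n                   ∎))
  where
  open ≤-Reasoning
  c⊆A++B : ∀ {y} → y ∈ c → y ∈ A ++ B
  c⊆A++B y∈ = ∈-remove A B (subst (_ ∈_) range≡ (∈-range⁺ (All.lookup c⊆ y∈))) (λ { refl → x∉c y∈ })

IsPerm⇒PermOf : ∀ {n w} → IsPerm n w → PermOf n w
IsPerm⇒PermOf {n} w↭ = perm
  (Unique-resp-↭ (↭⇒↭ₛ (↭-sym w↭)) (unique-oneTo n))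
  (All.tabulate (∈-oneTo⁻ ∘ ∈-resp-↭ w↭))
  (trans (↭-length w↭) (length-oneTo n))

PermOf⇒IsPerm : ∀ {n w} → PermOf n w → IsPerm n w
PermOf⇒IsPerm {n} p@(perm w! w⊆ _) =
  ∼bag⇒↭ (unique∧set⇒bag w! (unique-oneTo n) (mk⇔ (∈-oneTo⁺ ∘ All.lookup w⊆) (cover p ∘ ∈-oneTo⁻)))

PermOf-tail≥2 : ∀ {n s} → PermOf n (1 ∷ s) → All (2 ≤_) s
PermOf-tail≥2 (perm (1∉s ∷ _) (_ ∷ s⊆) _) = All.zipWith (λ (1≢x , (1≤x , _)) → ≤∧≢⇒< 1≤x 1≢x) (1∉s , s⊆)

one-or-more : ∀ {x} → 1 ≤ x → x ≡ 1 ⊎ 2 ≤ x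
one-or-more {suc zero}    _ = inj₁ refl
one-or-more {suc (suc x)} _ = inj₂ (s≤s (s≤s z≤n))

PermOf-lift : ∀ {n c} → PermOf n c → PermOf (suc n) (1 ∷ map suc c)
PermOf-lift {c = c} (perm c! c-bounded |c|) = perm
  (All.map (λ 1<x 1≡x → <-irrefl 1≡x 1<x) (All-map⁺ (All.map (λ (1≤x , _) → s≤s 1≤x) c-bounded))
    ∷ Unique.map⁺ suc-injective c!)
  ((≤-refl , s≤s (s≤s z≤n)) ∷ All-map⁺ (All.map (λ (1≤x , x<) → s≤s z≤n , s≤s x<) c-bounded))
  (cong suc (trans (length-map suc c) |c|))

PermOf-lift⁻ : ∀ {n c} → PermOf (suc n) (1 ∷ map suc c) → PermOf n c
PermOf-lift⁻ {c = c} (perm (1∉ ∷ c!) (_ ∷ c-bounded) |c|) = perm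
  (Unique.map⁻ c!)
  (All.tabulate bounded)
  (trans (sym (length-map suc c)) (suc-injective |c|))
  where
  bounded : ∀ {x} → x ∈ c → InInterval 1 _ x
  bounded {x} x∈ with All.lookup c-bounded (∈-map⁺ suc x∈)
  ... | _ , s≤s x<n = ≤∧≢⇒< z≤n (λ 0≡x → All.lookup 1∉ (∈-map⁺ suc x∈) (cong suc 0≡x)) , x<n

PermOf-reverse : ∀ {n r} → PermOf n (1 ∷ r) → PermOf n (1 ∷ reverse r)
PermOf-reverse {r = r} (perm c! c-bounded |c|) = perm
  (Unique-resp-↭ (↭⇒↭ₛ 1∷r↭) c!)
  (All.tabulate (λ x∈ → All.lookup c-bounded (∈-resp-↭ (↭-sym 1∷r↭) x∈)))
  (trans (cong suc (length-reverse r)) |c|)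
  where
  1∷r↭ : 1 ∷ r ↭ 1 ∷ reverse r
  1∷r↭ = ↭-prep 1 (↭-sym (↭-reverse r))

Rel₃ Rel₄ : Set₁
Rel₃ = ℕ → ℕ → ℕ → Set
Rel₄ = ℕ → ℕ → ℕ → ℕ → Set

record Pattern₃ (w : List ℕ) (R : Rel₃) : Set where
  constructor pattern₃
  field
    {x y z} : ℕ
    sub     : (x ∷ y ∷ z ∷ []) ⊆ w
    shape   : R x y z

record Pattern₄ (w : List ℕ) (R : Rel₄) : Set where
  constructor pattern₄
  field
    {x y z t} : ℕ
    sub       : (x ∷ y ∷ z ∷ t ∷ []) ⊆ w
    shape     : R x y z t

record ArcPattern₄ (E : List (ℕ × ℕ)) (R : Rel₄) : Set where
  constructor arcPattern₄
  field
    {p₁ p₂ p₃ p₄ q₁ q₂ q₃ q₄} : ℕ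
    arc₁  : (p₁ , q₁) ∈ E
    arc₂  : (p₂ , q₂) ∈ E
    arc₃  : (p₃ , q₃) ∈ E
    arc₄  : (p₄ , q₄) ∈ E
    p₁<p₂ : p₁ < p₂
    p₂<p₃ : p₂ < p₃
    p₃<p₄ : p₃ < p₄
    shape : R q₁ q₂ q₃ q₄

Shape213 Shape312 : Rel₃
Shape213 x y z = y < x × x < z
Shape312 x y z = y < z × z < x

-- Ends21 is the common shape of 3421 and 4321, Starts43 that of their inverses 4312 and 4321.
Desc₄ Ends21 Starts43 : Rel₄
Desc₄    x y z t = y < x × z < y × t < z
Ends21   x y z t = z < x × z < y × t < z
Starts43 x y z t = y < x × z < y × t < y

Desc₄⇒Ends21 : ∀ {x y z t} → Desc₄ x y z t → Ends21 x y z t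
Desc₄⇒Ends21 (y<x , z<y , t<z) = <-trans z<y y<x , z<y , t<z

Pattern₄-Desc₄⇒Ends21 : ∀ {w} → Pattern₄ w Desc₄ → Pattern₄ w Ends21
Pattern₄-Desc₄⇒Ends21 (pattern₄ sub r) = pattern₄ sub (Desc₄⇒Ends21 r)

Desc₄⇒Ends21-arcs : ∀ {E} → ArcPattern₄ E Desc₄ → ArcPattern₄ E Ends21
Desc₄⇒Ends21-arcs (arcPattern₄ a₁ a₂ a₃ a₄ p₁<p₂ p₂<p₃ p₃<p₄ r) =
  arcPattern₄ a₁ a₂ a₃ a₄ p₁<p₂ p₂<p₃ p₃<p₄ (Desc₄⇒Ends21 r)

⇔-holds : {A B : Set} → A → B → A ⇔ B
⇔-holds a b = mk⇔ (λ _ → b) (λ _ → a)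

⇔-fails : {A B : Set} → ¬ A → ¬ B → A ⇔ B
⇔-fails ¬a ¬b = mk⇔ (λ a → ⊥-elim (¬a a)) (λ b → ⊥-elim (¬b b))

orderIso₃ : ∀ {x y z a b c} → (y < x ⇔ b < a) → (z < x ⇔ c < a) → (z < y ⇔ c < b) →
            OrderIso (x ∷ y ∷ z ∷ []) (a ∷ b ∷ c ∷ [])
orderIso₃ yx zx zy = refl , λ where
  0 1 _ _ → yx
  0 2 _ _ → zx
  1 2 _ _ → zy
  s 0 () _
  (suc s) 1 (s≤s ()) _
  (suc (suc s)) 2 (s≤s (s≤s ())) _
  s (suc (suc (suc t))) _ (s≤s (s≤s (s≤s ())))

orderIso₄ : ∀ {x y z t a b c d} → (y < x ⇔ b < a) → (z < x ⇔ c < a) → (t < x ⇔ d < a) →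
            (z < y ⇔ c < b) → (t < y ⇔ d < b) → (t < z ⇔ d < c) →
            OrderIso (x ∷ y ∷ z ∷ t ∷ []) (a ∷ b ∷ c ∷ d ∷ [])
orderIso₄ yx zx tx zy ty tz = refl , λ where
  0 1 _ _ → yx
  0 2 _ _ → zx
  0 3 _ _ → tx
  1 2 _ _ → zy
  1 3 _ _ → ty
  2 3 _ _ → tz
  s 0 () _
  (suc s) 1 (s≤s ()) _
  (suc (suc s)) 2 (s≤s (s≤s ())) _
  (suc (suc (suc s))) 3 (s≤s (s≤s (s≤s ()))) _
  s (suc (suc (suc (suc t)))) _ (s≤s (s≤s (s≤s (s≤s ()))))

orderIso-at : ∀ {u σ} → OrderIso u σ → ∀ s t → {True (s <? t)} → {True (t <? length σ)} →
              (at u t < at u s) ⇔ (at σ t < at σ s)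
orderIso-at (_ , iso) s t {s<t} {t<ℓ} = iso s t (toWitness s<t) (toWitness t<ℓ)

contains-4321⇔ : ∀ {w} → Contains w (4 ∷ 3 ∷ 2 ∷ 1 ∷ []) ⇔ Pattern₄ w Desc₄
contains-4321⇔ = mk⇔
  (λ { ((x ∷ y ∷ z ∷ t ∷ []) , sub , iso@(refl , _)) → pattern₄ sub
         ( Equivalence.from (orderIso-at iso 0 1) (from-yes (3 <? 4))
         , Equivalence.from (orderIso-at iso 1 2) (from-yes (2 <? 3))
         , Equivalence.from (orderIso-at iso 2 3) (from-yes (1 <? 2))) })
  (λ { (pattern₄ sub (y<x , z<y , t<z)) → _ , sub , orderIso₄
         (⇔-holds y<x (from-yes (3 <? 4))) (⇔-holds (<-trans z<y y<x) (from-yes (2 <? 4)))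
         (⇔-holds (<-trans t<z (<-trans z<y y<x)) (from-yes (1 <? 4)))
         (⇔-holds z<y (from-yes (2 <? 3))) (⇔-holds (<-trans t<z z<y) (from-yes (1 <? 3)))
         (⇔-holds t<z (from-yes (1 <? 2))) })

contains-213⇔ : ∀ {w} → Unique w → Contains w (2 ∷ 1 ∷ 3 ∷ []) ⇔ Pattern₃ w Shape213
contains-213⇔ w! = mk⇔
  (λ { ((x ∷ y ∷ z ∷ []) , sub , iso@(refl , _)) → pattern₃ sub
         ( Equivalence.from (orderIso-at iso 0 1) (from-yes (1 <? 2))
         , ≤∧≢⇒< (≮⇒≥ (λ z<x → from-no (3 <? 2) (Equivalence.to (orderIso-at iso 0 2) z<x)))
                  (λ { refl → distinct-first-last (AllPairs-⊆ sub w!) })) })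
  (λ { (pattern₃ sub (y<x , x<z)) → _ , sub , orderIso₃
         (⇔-holds y<x (from-yes (1 <? 2)))
         (⇔-fails (λ z<x → <-asym z<x x<z) (from-no (3 <? 2)))
         (⇔-fails (λ z<y → <-asym z<y (<-trans y<x x<z)) (from-no (3 <? 1))) })
  where
  distinct-first-last : ∀ {x y} → ¬ Unique (x ∷ y ∷ x ∷ [])
  distinct-first-last ((_ ∷ x≢x ∷ []) ∷ _) = x≢x refl

contains-312⇔ : ∀ {w} → Unique w → Contains w (3 ∷ 1 ∷ 2 ∷ []) ⇔ Pattern₃ w Shape312
contains-312⇔ w! = mk⇔
  (λ { ((x ∷ y ∷ z ∷ []) , sub , iso@(refl , _)) → pattern₃ sub
         ( ≤∧≢⇒< (≮⇒≥ (λ z<y → from-no (2 <? 1) (Equivalence.to (orderIso-at iso 1 2) z<y)))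
                  (λ { refl → distinct-last-two (AllPairs-⊆ sub w!) })
         , Equivalence.from (orderIso-at iso 0 2) (from-yes (2 <? 3))) })
  (λ { (pattern₃ sub (y<z , z<x)) → _ , sub , orderIso₃
         (⇔-holds (<-trans y<z z<x) (from-yes (1 <? 3)))
         (⇔-holds z<x (from-yes (2 <? 3)))
         (⇔-fails (λ z<y → <-asym z<y y<z) (from-no (2 <? 1))) })
  where
  distinct-last-two : ∀ {x y} → ¬ Unique (x ∷ y ∷ y ∷ [])
  distinct-last-two (_ ∷ (y≢y ∷ []) ∷ _) = y≢y refl

Pattern₄-⊆ : ∀ {L L′ R} → L ⊆ L′ → Pattern₄ L R → Pattern₄ L′ R
Pattern₄-⊆ L⊆ (pattern₄ sub r) = pattern₄ (⊆-trans sub L⊆) r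

Pattern₃-⊆ : ∀ {L L′ R} → L ⊆ L′ → Pattern₃ L R → Pattern₃ L′ R
Pattern₃-⊆ L⊆ (pattern₃ sub r) = pattern₃ (⊆-trans sub L⊆) r

Pattern₃-short : ∀ {L R} → length L < 3 → ¬ Pattern₃ L R
Pattern₃-short |L|<3 (pattern₃ sub _) = <⇒≱ |L|<3 (Sublist.length-mono-≤ sub)

Monotone : (ℕ → ℕ) → Set
Monotone f = ∀ {a b} → a < b → f a < f b

reflect : ∀ {f} → Monotone f → ∀ {a b} → f a < f b → a < b
reflect {f} f↑ {a} {b} fa<fb with <-cmp a b
... | tri< a<b _ _    = a<b
... | tri≈ _ refl _  = ⊥-elim (<-irrefl refl fa<fb)
... | tri> _ _ b<a    = ⊥-elim (<-asym fa<fb (f↑ b<a))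

Pattern₃-map⁺ : ∀ {f} → Monotone f → ∀ {L} → Pattern₃ L Shape213 → Pattern₃ (map f L) Shape213
Pattern₃-map⁺ f↑ (pattern₃ sub (y<x , x<z)) = pattern₃ (Sublist.map⁺ _ sub) (f↑ y<x , f↑ x<z)

Pattern₃-map⁻ : ∀ {f} → Monotone f → ∀ L → Pattern₃ (map f L) Shape213 → Pattern₃ L Shape213
Pattern₃-map⁻ {f} f↑ L (pattern₃ sub (y<x , x<z)) with (x ∷ y ∷ z ∷ []) , refl , sub′ ← ⊆-map⁻ f L sub =
  pattern₃ sub′ (reflect f↑ y<x , reflect f↑ x<z)

Pattern₃-drop-least : ∀ {x L} → All (x ≤_) L → Pattern₃ (x ∷ L) Shape213 → Pattern₃ L Shape213
Pattern₃-drop-least x≤L (pattern₃ (_ ∷ʳ sub) r)              = pattern₃ sub r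
Pattern₃-drop-least x≤L (pattern₃ (refl ∷ sub) (y<x , _)) =
  ⊥-elim (<⇒≱ y<x (All.lookup x≤L (Sublist.Any-resp-⊆ sub (here refl))))

Pattern₃-drop-one : ∀ {L} → Pattern₃ (1 ∷ L) Shape312 → Pattern₃ L Shape312
Pattern₃-drop-one (pattern₃ (_ ∷ʳ sub) r) = pattern₃ sub r
Pattern₃-drop-one (pattern₃ (refl ∷ _) (y<z , z<1)) = ⊥-elim (n≮0 (<-≤-trans y<z (≤-pred z<1)))

-- Read backwards, Shape312 is Shape213 and vice versa.
Pattern₃-reverse : ∀ {r R} → Pattern₃ (reverse r) R → Pattern₃ r (λ x y z → R z y x)
Pattern₃-reverse {r} (pattern₃ sub shape) =
  pattern₃ (subst (_ ⊆_) (reverse-involutive r) (Sublist.reverse⁺ sub)) shape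

-- The arcs of a cycle form and the permutation they define

headOr : ℕ → List ℕ → ℕ
headOr h []      = h
headOr h (x ∷ _) = x

succPairs : ℕ → List ℕ → List (ℕ × ℕ)
succPairs h []       = []
succPairs h (y ∷ ys) = (y , headOr h ys) ∷ succPairs h ys

-- For a cycle form c = 1 c₂ … cₙ these are the arcs cᵢ ↦ cᵢ₊₁ of the cycle, closed by cₙ ↦ 1;
-- fromCycle n c is the permutation they define, in one-line notation.
arcs : List ℕ → List (ℕ × ℕ)
arcs = succPairs 1

lookupArc : List (ℕ × ℕ) → ℕ → ℕ
lookupArc []             x = 1
lookupArc ((p , q) ∷ E) x with x ≟ p
... | yes _ = q
... | no  _ = lookupArc E x

fromCycle : ℕ → List ℕ → List ℕ
fromCycle n c = map (lookupArc (arcs c)) (oneTo n)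

sources-succPairs : ∀ h L → map proj₁ (succPairs h L) ≡ L
sources-succPairs h []      = refl
sources-succPairs h (x ∷ L) = cong (x ∷_) (sources-succPairs h L)

targets-succPairs : ∀ h x L → map proj₂ (succPairs h (x ∷ L)) ≡ L ++ [ h ]
targets-succPairs h x []      = refl
targets-succPairs h x (y ∷ L) = cong (y ∷_) (targets-succPairs h y L)

∈-succPairs⁻ : ∀ {h p q} L → (p , q) ∈ succPairs h L →
  (∃₂ λ A B → L ≡ A ++ p ∷ q ∷ B) ⊎ (∃ λ A → L ≡ A ++ [ p ] × q ≡ h)
∈-succPairs⁻ (y ∷ [])     (here refl) = inj₂ ([] , refl , refl)
∈-succPairs⁻ (y ∷ z ∷ L)  (here refl) = inj₁ ([] , L , refl)
∈-succPairs⁻ (y ∷ L)      (there pq∈) with ∈-succPairs⁻ L pq∈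
... | inj₁ (A , B , refl)    = inj₁ (y ∷ A , B , refl)
... | inj₂ (A , refl , refl) = inj₂ (y ∷ A , refl , refl)

∈-succPairs-mid : ∀ h A p q B → (p , q) ∈ succPairs h (A ++ p ∷ q ∷ B)
∈-succPairs-mid h []      p q B = here refl
∈-succPairs-mid h (a ∷ A) p q B = there (∈-succPairs-mid h A p q B)

∈-succPairs-last : ∀ h A p → (p , h) ∈ succPairs h (A ++ [ p ])
∈-succPairs-last h []      p = here refl
∈-succPairs-last h (a ∷ A) p = there (∈-succPairs-last h A p)

succPairs-++ : ∀ h A B → succPairs h (A ++ B) ≡ succPairs (headOr h B) A ++ succPairs h B
succPairs-++ h []           B       = refl
succPairs-++ h (a ∷ [])     []      = refl
succPairs-++ h (a ∷ [])     (b ∷ B) = refl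
succPairs-++ h (a ∷ a′ ∷ A) B       = cong ((a , a′) ∷_) (succPairs-++ h (a′ ∷ A) B)

source∈ : ∀ {h p q} L → (p , q) ∈ succPairs h L → p ∈ L
source∈ {h} L pq∈ = subst (_ ∈_) (sources-succPairs h L) (∈-map⁺ proj₁ pq∈)

target∈ : ∀ {h p q} L → (p , q) ∈ succPairs h L → q ∈ L ⊎ q ≡ h
target∈ (y ∷ [])    (here refl) = inj₂ refl
target∈ (y ∷ z ∷ L) (here refl) = inj₁ (there (here refl))
target∈ (y ∷ L)     (there pq∈) with target∈ L pq∈
... | inj₁ q∈  = inj₁ (there q∈)
... | inj₂ q≡h = inj₂ q≡h

lookupArc-∈ : ∀ E {p} → p ∈ map proj₁ E → (p , lookupArc E p) ∈ E
lookupArc-∈ ((a , b) ∷ E) {p} p∈ with p ≟ a | p∈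
... | yes refl | _          = here refl
... | no  p≢a  | here p≡a   = ⊥-elim (p≢a p≡a)
... | no  _    | there p∈E  = there (lookupArc-∈ E p∈E)

lookupArc-correct : ∀ E {p q} → Unique (map proj₁ E) → (p , q) ∈ E → lookupArc E p ≡ q
lookupArc-correct E sources! pq∈ =
  cong proj₂ (unique-map⁻ proj₁ sources! (lookupArc-∈ E (∈-map⁺ proj₁ pq∈)) pq∈ refl)

arc-at : ∀ {c} X {p q} Y → c ≡ X ++ p ∷ q ∷ Y → (p , q) ∈ arcs c
arc-at X Y refl = ∈-succPairs-mid 1 X _ _ Y

arc-bounded : ∀ {n c p q} → PermOf n c → (p , q) ∈ arcs c → InInterval 1 n p × InInterval 1 n q
arc-bounded {c = c} (perm _ c-bounded _) a with All.lookup c-bounded (source∈ c a) | target∈ c a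
... | p∈ | inj₁ q∈c  = p∈ , All.lookup c-bounded q∈c
... | p∈ | inj₂ refl = p∈ , ≤-refl , ≤-<-trans (proj₁ p∈) (proj₂ p∈)

arcPattern-small : ∀ {n c R} → PermOf n c → n ≤ 3 → ¬ ArcPattern₄ (arcs c) R
arcPattern-small c-perm n≤3 (arcPattern₄ {p₄ = p₄} a₁ _ _ a₄ p₁<p₂ p₂<p₃ p₃<p₄ _) =
  <-irrefl refl (≤-trans 4≤p₄ (≤-trans (≤-pred (proj₂ (proj₁ (arc-bounded c-perm a₄)))) n≤3))
  where
  4≤p₄ : 4 ≤ p₄
  4≤p₄ = ≤-trans (s≤s (≤-trans (s≤s (≤-trans (s≤s (proj₁ (proj₁ (arc-bounded c-perm a₁)))) p₁<p₂)) p₂<p₃)) p₃<p₄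

-- One-line notation versus cycle form

module FromCycle {n s} (c-perm : PermOf n (1 ∷ s)) where

  open PermOf c-perm

  private
    c : List ℕ
    c = 1 ∷ s

    π : ℕ → ℕ
    π = lookupArc (arcs c)

    w : List ℕ
    w = fromCycle n c

    sources! : Unique (map proj₁ (arcs c))
    sources! = subst Unique (sym (sources-succPairs 1 c)) unique

    targets! : Unique (map proj₂ (arcs c))
    targets! = subst Unique (sym (targets-succPairs 1 1 s)) (Unique-resp-↭ (↭⇒↭ₛ (++-comm (1 ∷ []) s)) unique)

    arc-of : ∀ {x} → InInterval 1 n x → (x , π x) ∈ arcs c
    arc-of {x} x∈ = lookupArc-∈ (arcs c) (subst (x ∈_) (sym (sources-succPairs 1 c)) (cover c-perm x∈))

    π-arc : ∀ {p q} → (p , q) ∈ arcs c → π p ≡ q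
    π-arc = lookupArc-correct (arcs c) sources!

    π-bounded : ∀ {x} → InInterval 1 n x → InInterval 1 n (π x)
    π-bounded x∈ with target∈ c (arc-of x∈)
    ... | inj₁ πx∈c  = All.lookup bounded πx∈c
    ... | inj₂ πx≡1 = subst (InInterval 1 n) (sym πx≡1) (All.head bounded)

    π-injective : InjectiveOn π (oneTo n)
    π-injective x∈ y∈ πx≡πy =
      cong proj₁ (unique-map⁻ proj₂ targets! (arc-of (∈-oneTo⁻ x∈)) (arc-of (∈-oneTo⁻ y∈)) πx≡πy)

  fromCycle-perm : PermOf n w
  fromCycle-perm = perm
    (unique-map⁺ π-injective (unique-oneTo n))
    (All.tabulate bounded-w)
    (trans (length-map π (oneTo n)) (length-oneTo n))
    where
    bounded-w : ∀ {y} → y ∈ w → InInterval 1 n y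
    bounded-w y∈ with x , x∈ , refl ← ∈-map⁻ π y∈ =
      π-bounded (∈-oneTo⁻ x∈)

  private
    app-w : ∀ {x} → InInterval 1 n x → app w x ≡ π x
    app-w = app-map-oneTo n π

  cycleForm-fromCycle : cycleForm n w ≡ c
  cycleForm-fromCycle = subst (λ m → orbitFrom w m 1 ≡ c) length≡ (orbit s [] 1 refl)
    where
    orbit : ∀ S A x → c ≡ A ++ x ∷ S → orbitFrom w (suc (length S)) x ≡ x ∷ S
    orbit []      A x c≡ = refl
    orbit (y ∷ S) A x c≡ = cong (x ∷_) (trans (cong (orbitFrom w (suc (length S))) step)
      (orbit S (A ++ [ x ]) y (trans c≡ (sym (++-assoc A [ x ] (y ∷ S))))))
      where
      step : app w x ≡ y
      step = trans (app-w (All.lookup bounded (subst (x ∈_) (sym c≡) (∈-++⁺ʳ A (here refl)))))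
                   (π-arc (subst (λ L → (x , y) ∈ arcs L) (sym c≡) (∈-succPairs-mid 1 A x y S)))

  pattern⇒arcPattern : ∀ {R} → Pattern₄ w R → ArcPattern₄ (arcs c) R
  pattern⇒arcPattern (pattern₄ sub r) with ⊆-map⁻ π (oneTo n) sub
  ... | (p₁ ∷ p₂ ∷ p₃ ∷ p₄ ∷ []) , refl , ps⊆ with AllPairs-⊆ ps⊆ (oneTo-increasing n)
  ...   | (p₁<p₂ ∷ _) ∷ (p₂<p₃ ∷ _) ∷ (p₃<p₄ ∷ _) ∷ _ =
    arcPattern₄ (arc-of (bound (here refl))) (arc-of (bound (there (here refl))))
                (arc-of (bound (there (there (here refl))))) (arc-of (bound (there (there (there (here refl))))))
                p₁<p₂ p₂<p₃ p₃<p₄ r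
    where
    bound : ∀ {p} → p ∈ p₁ ∷ p₂ ∷ p₃ ∷ p₄ ∷ [] → InInterval 1 n p
    bound p∈ = ∈-oneTo⁻ (Sublist.Any-resp-⊆ ps⊆ p∈)

  arcPattern⇒pattern : ∀ {R} → ArcPattern₄ (arcs c) R → Pattern₄ w R
  arcPattern⇒pattern (arcPattern₄ {p₁} {p₂} {p₃} {p₄} {q₁} {q₂} {q₃} {q₄} a₁ a₂ a₃ a₄ p₁<p₂ p₂<p₃ p₃<p₄ r) =
    pattern₄ (subst (_⊆ w) targets (subsequence-at 1 w sorted (bound a₁ ∷ bound a₂ ∷ bound a₃ ∷ bound a₄ ∷ []))) r
    where
    sorted : AllPairs _<_ (p₁ ∷ p₂ ∷ p₃ ∷ p₄ ∷ [])
    sorted = Linked⇒AllPairs <-trans (p₁<p₂ ∷ p₂<p₃ ∷ p₃<p₄ ∷ [-])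
    bound : ∀ {p q} → (p , q) ∈ arcs c → InInterval 1 (length w) p
    bound a = subst (λ m → InInterval 1 m _) (sym (PermOf.length≡ fromCycle-perm)) (All.lookup bounded (source∈ c a))
    app-arc : ∀ {p q} → (p , q) ∈ arcs c → app w p ≡ q
    app-arc a = trans (app-w (All.lookup bounded (source∈ c a))) (π-arc a)
    targets : map (app w) (p₁ ∷ p₂ ∷ p₃ ∷ p₄ ∷ []) ≡ q₁ ∷ q₂ ∷ q₃ ∷ q₄ ∷ []
    targets = cong₂ _∷_ (app-arc a₁) (cong₂ _∷_ (app-arc a₂) (cong₂ _∷_ (app-arc a₃) (cong₂ _∷_ (app-arc a₄) refl)))

length-orbitFrom : ∀ w k x → length (orbitFrom w k x) ≡ k
length-orbitFrom w zero    x = refl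
length-orbitFrom w (suc k) x = cong suc (length-orbitFrom w k (app w x))

module CycleForm {m w} (w-perm : IsPerm (suc m) w) (w-cyclic : Cyclic (suc m) w) where

  private
    n : ℕ
    n = suc m

    c : List ℕ
    c = cycleForm n w

    open PermOf (IsPerm⇒PermOf w-perm)

    position : ∀ {x} → InInterval 1 n x → x ∸ 1 < length w
    position {suc x} (_ , s≤s x<n) = subst (x <_) (sym length≡) x<n

    app-bounded : ∀ {x} → InInterval 1 n x → InInterval 1 n (app w x)
    app-bounded x∈ = All.lookup bounded (at-∈ w _ (position x∈))

    app-injective : ∀ {x y} → InInterval 1 n x → InInterval 1 n y → app w x ≡ app w y → x ≡ y
    app-injective {suc x} {suc y} x∈ y∈ eq = cong suc (at-injective w unique (position x∈) (position y∈) eq)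

    orbit-bounded : ∀ k {x} → InInterval 1 n x → All (InInterval 1 n) (orbitFrom w k x)
    orbit-bounded zero    x∈ = []
    orbit-bounded (suc k) x∈ = x∈ ∷ orbit-bounded k (app-bounded x∈)

  cycleForm-perm : PermOf n c
  cycleForm-perm = perm w-cyclic (orbit-bounded n (≤-refl , s≤s (s≤s z≤n))) (length-orbitFrom w n 1)

  private
    c-bounded : ∀ {x} → x ∈ c → InInterval 1 n x
    c-bounded = All.lookup (PermOf.bounded cycleForm-perm)

    last-bounded : ∀ A {l} → c ≡ A ++ [ l ] → InInterval 1 n l
    last-bounded A {l} c≡ = c-bounded (subst (l ∈_) (sym c≡) (∈-++⁺ʳ A (here refl)))

    app-consecutive : ∀ k x A {p q} B → orbitFrom w k x ≡ A ++ p ∷ q ∷ B → app w p ≡ q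
    app-consecutive zero          x []      B ()
    app-consecutive zero          x (_ ∷ A) B ()
    app-consecutive (suc zero)    x []      B eq with () ← ∷-injectiveʳ eq
    app-consecutive (suc (suc k)) x []      B eq =
      trans (cong (app w) (sym (∷-injectiveˡ eq))) (∷-injectiveˡ (∷-injectiveʳ eq))
    app-consecutive (suc k)       x (_ ∷ A) B eq = app-consecutive k (app w x) A B (∷-injectiveʳ eq)

    -- The orbit of 1 closes up: the image of its last element is 1, since every other candidate
    -- is already the image of an earlier element.
    app-last : ∀ A {l} → c ≡ A ++ [ l ] → app w l ≡ 1
    app-last A {l} c≡ with cover cycleForm-perm (app-bounded (last-bounded A c≡))
    ... | here wl≡1 = wl≡1
    ... | there wl∈ with P , p , Q , c≡′ ← split-before 1 (orbitFrom w m (app w 1)) wl∈ =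
      ⊥-elim (unique-mid P (subst Unique c≡″ w-cyclic) (last-∈ (P ++ [ l ]) A (begin
        (P ++ [ l ]) ++ app w l ∷ Q ≡⟨ ++-assoc P [ l ] _ ⟩
        P ++ l ∷ app w l ∷ Q        ≡⟨ sym c≡″ ⟩
        c                           ≡⟨ c≡ ⟩
        A ++ [ l ]                  ∎)))
      where
      open ≡-Reasoning
      p≡l : p ≡ l
      p≡l = app-injective (c-bounded (subst (p ∈_) (sym c≡′) (∈-++⁺ʳ P (here refl)))) (last-bounded A c≡)
                          (app-consecutive n 1 P Q c≡′)
      c≡″ : c ≡ P ++ l ∷ app w l ∷ Q
      c≡″ = trans c≡′ (cong (λ x → P ++ x ∷ app w l ∷ Q) p≡l)

    app-arc : ∀ {p q} → (p , q) ∈ arcs c → app w p ≡ q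
    app-arc a with ∈-succPairs⁻ c a
    ... | inj₁ (A , B , c≡)    = app-consecutive n 1 A B c≡
    ... | inj₂ (A , c≡ , refl) = app-last A c≡

  fromCycle-cycleForm : fromCycle n c ≡ w
  fromCycle-cycleForm = begin
    map (lookupArc (arcs c)) (oneTo n)  ≡⟨ map-cong-local (All.tabulate (sym ∘ app-lookupArc)) ⟩
    map (app w) (oneTo n)               ≡⟨ cong (map (app w)) (oneTo≡range n) ⟩
    map (app w) (range 1 n)             ≡⟨ cong (λ k → map (app w) (range 1 k)) (sym length≡) ⟩
    map (app w) (range 1 (length w))    ≡⟨ map-at-range 1 w ⟩
    w                                   ∎
    where
    open ≡-Reasoning
    app-lookupArc : ∀ {x} → x ∈ oneTo n → app w x ≡ lookupArc (arcs c) x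
    app-lookupArc {x} x∈ = app-arc (lookupArc-∈ (arcs c) (subst (x ∈_) (sym (sources-succPairs 1 c))
      (cover cycleForm-perm (∈-oneTo⁻ x∈))))

-- Reversing a cycle form inverts the permutation

reverse-mid : ∀ (A : List ℕ) x B → reverse (A ++ x ∷ B) ≡ reverse B ++ x ∷ reverse A
reverse-mid A x B = begin
  reverse (A ++ x ∷ B)          ≡⟨ reverse-++ A (x ∷ B) ⟩
  reverse (x ∷ B) ++ reverse A  ≡⟨ cong (_++ reverse A) (unfold-reverse x B) ⟩
  (reverse B ++ [ x ]) ++ reverse A ≡⟨ ++-assoc (reverse B) [ x ] (reverse A) ⟩
  reverse B ++ x ∷ reverse A    ∎
  where open ≡-Reasoning

arc-reverse : ∀ r {p q} → (p , q) ∈ arcs (1 ∷ reverse r) → (q , p) ∈ arcs (1 ∷ r)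
arc-reverse r (here refl) with reverse r in r≡
... | []     = subst (λ r → (1 , 1) ∈ arcs (1 ∷ r)) (reverse-selfInverse r≡) (here refl)
... | l ∷ P  = subst (λ r → (l , 1) ∈ arcs (1 ∷ r)) (trans (sym (unfold-reverse l P)) (reverse-selfInverse r≡))
                     (there (∈-succPairs-last 1 (reverse P) l))
arc-reverse r (there a) with ∈-succPairs⁻ (reverse r) a
... | inj₁ (A , B , r≡)    =
  there (subst (λ r → _ ∈ succPairs 1 r) r≡′ (∈-succPairs-mid 1 (reverse B) _ _ (reverse A)))
  where
  r≡′ : reverse B ++ _ ∷ _ ∷ reverse A ≡ r
  r≡′ = trans (trans (sym (++-assoc (reverse B) [ _ ] _)) (cong (_++ _) (sym (unfold-reverse _ B))))
              (trans (sym (reverse-mid A _ (_ ∷ B))) (reverse-selfInverse r≡))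
... | inj₂ (A , r≡ , refl) =
  subst (λ r → _ ∈ arcs (1 ∷ r)) (trans (sym (reverse-++ A [ _ ])) (reverse-selfInverse r≡)) (here refl)

Desc₄-reverse : ∀ r → ArcPattern₄ (arcs (1 ∷ reverse r)) Desc₄ → ArcPattern₄ (arcs (1 ∷ r)) Desc₄
Desc₄-reverse r (arcPattern₄ a₁ a₂ a₃ a₄ p₁<p₂ p₂<p₃ p₃<p₄ (q₂<q₁ , q₃<q₂ , q₄<q₃)) =
  arcPattern₄ (arc-reverse r a₄) (arc-reverse r a₃) (arc-reverse r a₂) (arc-reverse r a₁)
              q₄<q₃ q₃<q₂ q₂<q₁ (p₃<p₄ , p₂<p₃ , p₁<p₂)

-- The last two arcs of a Starts43 pattern have distinct targets, whose order decides how the flipped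
-- arcs are sorted.
Starts43-reverse : ∀ r → Unique (1 ∷ r) →
                   ArcPattern₄ (arcs (1 ∷ reverse r)) Starts43 → ArcPattern₄ (arcs (1 ∷ r)) Ends21
Starts43-reverse r c! (arcPattern₄ {q₃ = q₃} {q₄ = q₄} a₁ a₂ a₃ a₄ p₁<p₂ p₂<p₃ p₃<p₄ (q₂<q₁ , q₃<q₂ , q₄<q₂))
  with <-cmp q₃ q₄
... | tri< q₃<q₄ _ _ = arcPattern₄ (arc-reverse r a₃) (arc-reverse r a₄) (arc-reverse r a₂) (arc-reverse r a₁)
                         q₃<q₄ q₄<q₂ q₂<q₁ (p₂<p₃ , <-trans p₂<p₃ p₃<p₄ , p₁<p₂)
... | tri> _ _ q₄<q₃ = arcPattern₄ (arc-reverse r a₄) (arc-reverse r a₃) (arc-reverse r a₂) (arc-reverse r a₁)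
                         q₄<q₃ q₃<q₂ q₂<q₁ (<-trans p₂<p₃ p₃<p₄ , p₂<p₃ , p₁<p₂)
... | tri≈ _ refl _  =
  ⊥-elim (<-irrefl (cong proj₂ (unique-map⁻ proj₁ sources! (arc-reverse r a₃) (arc-reverse r a₄) refl)) p₃<p₄)
  where
  sources! : Unique (map proj₁ (arcs (1 ∷ r)))
  sources! = subst Unique (sym (sources-succPairs 1 (1 ∷ r))) c!

-- Relabellings of arc endpoints: shift d moves every entry x ≥ 2 up to d + x, as consTwo (d = 1) and
-- snocRun e (d = e + 1) do; shiftTarget d also redirects the closing arc x ↦ 1 of 1 ∷ t to d + x ↦ 2.
shift shiftTarget : ℕ → ℕ → ℕ
shift d 0             = 0
shift d 1             = 1
shift d (suc (suc x)) = d + suc (suc x)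

shiftTarget d 0             = 0
shiftTarget d 1             = 2
shiftTarget d (suc (suc x)) = d + suc (suc x)

shift-≥2 : ∀ d {x} → 2 ≤ x → shift d x ≡ d + x
shift-≥2 d {suc (suc x)} _ = refl
shift-≥2 d {1} (s≤s ())

shiftTarget-≥2 : ∀ d {x} → 2 ≤ x → shiftTarget d x ≡ d + x
shiftTarget-≥2 d {suc (suc x)} _ = refl
shiftTarget-≥2 d {1} (s≤s ())

shift-mono : ∀ d → Monotone (shift d)
shift-mono d {0}           {1}           _  = z<s
shift-mono d {0}           {suc (suc b)} _  = ≤-trans (s≤s z≤n) (m≤n+m _ d)
shift-mono d {1}           {suc (suc b)} _  = ≤-trans (s≤s (s≤s z≤n)) (m≤n+m _ d)
shift-mono d {suc (suc a)} {suc (suc b)} lt = +-monoʳ-< d lt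
shift-mono d {1}           {1}           (s≤s ())
shift-mono d {suc (suc a)} {1}           (s≤s ())
shift-mono d {suc a}       {0}           ()

shiftTarget-mono : ∀ e → Monotone (shiftTarget (suc e))
shiftTarget-mono e {0}           {1}           _  = z<s
shiftTarget-mono e {0}           {suc (suc b)} _  = ≤-trans (s≤s z≤n) (m≤n+m _ (suc e))
shiftTarget-mono e {1}           {suc (suc b)} _  = s≤s (≤-trans (s≤s (s≤s z≤n)) (m≤n+m _ e))
shiftTarget-mono e {suc (suc a)} {suc (suc b)} lt = +-monoʳ-< (suc e) lt
shiftTarget-mono e {1}           {1}           (s≤s ())
shiftTarget-mono e {suc (suc a)} {1}           (s≤s ())
shiftTarget-mono e {suc a}       {0}           ()

map-succPairs : ∀ (f g : ℕ → ℕ) h y L → (∀ {x} → x ∈ L → g x ≡ f x) →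
                map (Product.map f g) (succPairs h (y ∷ L)) ≡ succPairs (g h) (map f (y ∷ L))
map-succPairs f g h y []      _     = refl
map-succPairs f g h y (z ∷ L) g≗f = cong₂ _∷_ (cong (f y ,_) (g≗f (here refl)))
  (map-succPairs f g h z L (λ x∈ → g≗f (there x∈)))

preimage : ∀ {E′ : List (ℕ × ℕ)} (g h : ℕ → ℕ) {p q} → (p , q) ∈ map (Product.map g h) E′ →
           ∃₂ λ (a b : ℕ) → (a , b) ∈ E′ × p ≡ g a × q ≡ h b
preimage g h pq∈ with (a , b) , ab∈ , refl ← ∈-map⁻ _ pq∈ = a , b , ab∈ , refl , refl

pull : ∀ {E′ : List (ℕ × ℕ)} {R : Rel₄} {g h : ℕ → ℕ} →
       Monotone g → (∀ {a b c d} → R (h a) (h b) (h c) (h d) → R a b c d) →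
       ∀ {p₁ p₂ p₃ p₄ q₁ q₂ q₃ q₄} → let φE′ = map (Product.map g h) E′ in
       (p₁ , q₁) ∈ φE′ → (p₂ , q₂) ∈ φE′ → (p₃ , q₃) ∈ φE′ → (p₄ , q₄) ∈ φE′ →
       p₁ < p₂ → p₂ < p₃ → p₃ < p₄ → R q₁ q₂ q₃ q₄ → ArcPattern₄ E′ R
pull {g = g} {h} g↑ R-reflect a₁ a₂ a₃ a₄ p₁<p₂ p₂<p₃ p₃<p₄ r
  with _ , _ , a₁′ , refl , refl ← preimage g h a₁ | _ , _ , a₂′ , refl , refl ← preimage g h a₂
     | _ , _ , a₃′ , refl , refl ← preimage g h a₃ | _ , _ , a₄′ , refl , refl ← preimage g h a₄ =
  arcPattern₄ a₁′ a₂′ a₃′ a₄′ (reflect g↑ p₁<p₂) (reflect g↑ p₂<p₃) (reflect g↑ p₃<p₄) (R-reflect r)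

push : ∀ {E′ E : List (ℕ × ℕ)} {R : Rel₄} {g h : ℕ → ℕ} →
       Monotone g → (∀ {a b c d} → R a b c d → R (h a) (h b) (h c) (h d)) →
       (∀ {p q} → (p , q) ∈ E′ → (g p , h q) ∈ E) → ArcPattern₄ E′ R → ArcPattern₄ E R
push g↑ R-preserve E′→E (arcPattern₄ a₁ a₂ a₃ a₄ p₁<p₂ p₂<p₃ p₃<p₄ r) =
  arcPattern₄ (E′→E a₁) (E′→E a₂) (E′→E a₃) (E′→E a₄) (g↑ p₁<p₂) (g↑ p₂<p₃) (g↑ p₃<p₄) (R-preserve r)

Desc₄-map : ∀ {h : ℕ → ℕ} → Monotone h → ∀ {a b c d} → Desc₄ a b c d → Desc₄ (h a) (h b) (h c) (h d)
Desc₄-map h↑ (b<a , c<b , d<c) = h↑ b<a , h↑ c<b , h↑ d<c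

Ends21-unmap : ∀ {h : ℕ → ℕ} → Monotone h → ∀ {a b c d} → Ends21 (h a) (h b) (h c) (h d) → Ends21 a b c d
Ends21-unmap h↑ (c<a , c<b , d<c) = reflect h↑ c<a , reflect h↑ c<b , reflect h↑ d<c

consTwo : List ℕ → List ℕ
consTwo s = 2 ∷ map suc s

snocRun : ℕ → List ℕ → List ℕ
snocRun e t = map (suc e +_) t ++ range 2 (suc e)

-- The cycle forms 1 ∷ s of the permutations counted: either 2 follows 1 and the rest is a smaller such
-- form shifted up by one, or the form ends with the run 2, 3, …, e + 2 and is preceded by a smaller
-- such form (without its 1) shifted up by e + 1.
data Tree : ℕ → List ℕ → Set where
  one  : Tree 1 []
  cons : ∀ {n s} → Tree (suc n) s → Tree (suc (suc n)) (consTwo s)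
  snoc : ∀ {j t} e → Tree (2 + j) t → Tree (3 + e + j) (snocRun e t)

record Admissible (R : Rel₄) (n : ℕ) (s : List ℕ) : Set where
  constructor admissible
  field
    isPerm     : PermOf n (1 ∷ s)
    avoids213  : ¬ Pattern₃ (1 ∷ s) Shape213
    avoidsArcs : ¬ ArcPattern₄ (arcs (1 ∷ s)) R

arcs-consTwo : ∀ s → All (2 ≤_) s → arcs (1 ∷ consTwo s) ≡ (1 , 2) ∷ map (Product.map suc (shift 1)) (arcs (1 ∷ s))
arcs-consTwo s s≥2 =
  cong ((1 , 2) ∷_) (sym (map-succPairs suc (shift 1) 1 1 s (λ x∈ → shift-≥2 1 (All.lookup s≥2 x∈))))

arcs-snocRun : ∀ e t → All (2 ≤_) t →
  arcs (1 ∷ snocRun e t) ≡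
  map (Product.map (shift (suc e)) (shiftTarget (suc e))) (arcs (1 ∷ t)) ++ succPairs 1 (range 2 (suc e))
arcs-snocRun e t t≥2 = begin
  succPairs 1 ((1 ∷ map (suc e +_) t) ++ range 2 (suc e))
    ≡⟨ succPairs-++ 1 (1 ∷ map (suc e +_) t) (range 2 (suc e)) ⟩
  succPairs 2 (1 ∷ map (suc e +_) t) ++ succPairs 1 (range 2 (suc e))
    ≡⟨ cong (λ L → succPairs 2 (1 ∷ L) ++ succPairs 1 (range 2 (suc e)))
            (map-cong-local (All.map (sym ∘ shift-≥2 (suc e)) t≥2)) ⟩
  succPairs 2 (1 ∷ map (shift (suc e)) t) ++ succPairs 1 (range 2 (suc e))
    ≡⟨ cong (_++ succPairs 1 (range 2 (suc e))) (sym (map-succPairs (shift (suc e)) (shiftTarget (suc e)) 1 1 t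
         (λ x∈ → trans (shiftTarget-≥2 (suc e) (All.lookup t≥2 x∈)) (sym (shift-≥2 (suc e) (All.lookup t≥2 x∈)))))) ⟩
  map (Product.map (shift (suc e)) (shiftTarget (suc e))) (arcs (1 ∷ t)) ++ succPairs 1 (range 2 (suc e)) ∎
  where open ≡-Reasoning

∈-runArcs⁻ : ∀ {p q} a n → (p , q) ∈ succPairs 1 (range a n) → InInterval a n p × (q ≡ suc p ⊎ q ≡ 1)
∈-runArcs⁻ {p} {q} a n pq∈ with ∈-succPairs⁻ (range a n) pq∈
... | inj₁ (A , B , range≡) = p∈ A range≡ , inj₁ (consecutive a n A range≡)
  where
  p∈ : ∀ A {r : List ℕ} → range a n ≡ A ++ p ∷ r → InInterval a n p
  p∈ A range≡ = ∈-range⁻ (subst (p ∈_) (sym range≡) (∈-++⁺ʳ A (here refl)))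
  consecutive : ∀ a n A {B} → range a n ≡ A ++ p ∷ q ∷ B → q ≡ suc p
  consecutive a (suc (suc n)) []      eq = trans (sym (∷-injectiveˡ (∷-injectiveʳ eq))) (cong suc (∷-injectiveˡ eq))
  consecutive a (suc zero)    []      eq with () ← ∷-injectiveʳ eq
  consecutive a (suc n)       (_ ∷ A) eq = consecutive (suc a) n A (∷-injectiveʳ eq)
... | inj₂ (A , range≡ , q≡1) = ∈-range⁻ (subst (p ∈_) (sym range≡) (∈-++⁺ʳ A (here refl))) , inj₂ q≡1

-- Soundness

admissible-one : ∀ {R} → Admissible R 1 []
admissible-one = admissible one-perm (Pattern₃-short (s≤s (s≤s z≤n))) (arcPattern-small one-perm (s≤s z≤n))
  where
  one-perm : PermOf 1 (1 ∷ [])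
  one-perm = perm ([] ∷ []) ((≤-refl , ≤-refl) ∷ []) refl

module _ {E′ : List (ℕ × ℕ)} where

  private
    φE′ : List (ℕ × ℕ)
    φE′ = map (Product.map suc (shift 1)) E′

    source≥1 : ∀ {p q} → (p , q) ∈ (1 , 2) ∷ φE′ → 1 ≤ p
    source≥1 (here refl) = ≤-refl
    source≥1 (there a) with _ , _ , _ , refl , _ ← preimage suc (shift 1) a = s≤s z≤n

    target>0 : (∀ {p q} → (p , q) ∈ E′ → 1 ≤ q) → ∀ {p q} → (p , q) ∈ φE′ → 0 < q
    target>0 targets≥1 a with _ , b , b∈ , _ , refl ← preimage suc (shift 1) a = shift-mono 1 (targets≥1 b∈)

    later : ∀ {p q} → 1 < p → (p , q) ∈ (1 , 2) ∷ φE′ → (p , q) ∈ φE′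
    later 1<1 (here refl) = ⊥-elim (<-irrefl refl 1<1)
    later _   (there a)   = a

  -- The arc (1, 2) cannot start an Ends21 pattern: the two targets below 2 would have to be distinct
  -- and positive.
  pull-consTwo : (∀ {p q} → (p , q) ∈ E′ → 1 ≤ q) →
                 ArcPattern₄ ((1 , 2) ∷ φE′) Ends21 → ArcPattern₄ E′ Ends21
  pull-consTwo targets≥1 (arcPattern₄ {p₁} {p₂} {p₃} {p₄} {q₁} {q₂} {q₃} {q₄}
                                     a₁ a₂ a₃ a₄ p₁<p₂ p₂<p₃ p₃<p₄ r@(q₃<q₁ , _ , q₄<q₃)) =
    pull s≤s (Ends21-unmap (shift-mono 1)) (first a₁) a₂′ (later 1<p₃ a₃) a₄′ p₁<p₂ p₂<p₃ p₃<p₄ r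
    where
    1<p₂ : 1 < p₂
    1<p₂ = ≤-<-trans (source≥1 a₁) p₁<p₂
    1<p₃ : 1 < p₃
    1<p₃ = <-trans 1<p₂ p₂<p₃
    a₂′ : (p₂ , q₂) ∈ φE′
    a₂′ = later 1<p₂ a₂
    a₄′ : (p₄ , q₄) ∈ φE′
    a₄′ = later (<-trans 1<p₃ p₃<p₄) a₄
    first : (p₁ , q₁) ∈ (1 , 2) ∷ φE′ → (p₁ , q₁) ∈ φE′
    first (here refl) = ⊥-elim (<-irrefl refl (≤-<-trans (≤-trans (s≤s (target>0 targets≥1 a₄′)) q₄<q₃) q₃<q₁))
    first (there a)   = a

admissible-consTwo : ∀ {n s} → Admissible Ends21 (suc n) s → Admissible Ends21 (suc (suc n)) (consTwo s)
admissible-consTwo {n} {s} (admissible c-perm no213 noArcs) = admissible (PermOf-lift c-perm) no213′ noArcs′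
  where
  no213′ : ¬ Pattern₃ (1 ∷ consTwo s) Shape213
  no213′ P = no213 (Pattern₃-map⁻ s≤s (1 ∷ s)
    (Pattern₃-drop-least (All-map⁺ (All.tabulate {xs = 1 ∷ s} (λ _ → s≤s z≤n))) P))
  noArcs′ : ¬ ArcPattern₄ (arcs (1 ∷ consTwo s)) Ends21
  noArcs′ A = noArcs (pull-consTwo (λ a → proj₁ (proj₂ (arc-bounded c-perm a)))
    (subst (λ E → ArcPattern₄ E Ends21) (arcs-consTwo s (PermOf-tail≥2 c-perm)) A))

module SnocRun (e : ℕ) {t : List ℕ} (t≥2 : All (2 ≤_) t) where

  d : ℕ
  d = suc e

  high : List ℕ
  high = map (d +_) t

  run : List ℕ
  run = range 2 d

  above : ∀ {x} → 2 ≤ x → 3 + e ≤ d + x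
  above {x} 2≤x = subst (_≤ d + x) (cong suc (+-comm e 2)) (+-monoʳ-≤ d 2≤x)

  high≥ : All (3 + e ≤_) high
  high≥ = All-map⁺ (All.map above t≥2)

  run< : ∀ {y} → y ∈ run → 2 ≤ y × y < 3 + e
  run< = ∈-range⁻

  run<high : ∀ {x y} → x ∈ high → y ∈ run → y < x
  run<high x∈ y∈ = <-≤-trans (proj₂ (run< y∈)) (All.lookup high≥ x∈)

  snocRun≥2 : All (2 ≤_) (high ++ run)
  snocRun≥2 = All-++⁺ (All.map (≤-trans (s≤s (s≤s z≤n))) high≥) (All.tabulate (λ y∈ → proj₁ (run< y∈)))

  PermOf-snocRun : ∀ {j} → PermOf (2 + j) (1 ∷ t) → PermOf (3 + e + j) (1 ∷ snocRun e t)
  PermOf-snocRun {j} (perm (_ ∷ t!) (_ ∷ t-bounded) |1∷t|) = perm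
    (All.map (λ 2≤y 1≡y → <-irrefl 1≡y 2≤y) snocRun≥2 ∷
     Unique.++⁺ (Unique.map⁺ (+-cancelˡ-≡ d _ _) t!) (unique-range 2 d)
                (λ (y∈high , y∈run) → <-irrefl refl (run<high y∈high y∈run)))
    ((≤-refl , s≤s (s≤s z≤n)) ∷ All.tabulate bounded)
    (cong suc (begin
      length (high ++ run)          ≡⟨ length-++ high ⟩
      length high + length run      ≡⟨ cong₂ _+_ (length-map (d +_) t) (length-range 2 d) ⟩
      length t + d                  ≡⟨ cong (_+ d) (suc-injective |1∷t|) ⟩
      suc j + suc e                 ≡⟨ cong suc (trans (+-suc j e) (cong suc (+-comm j e))) ⟩
      suc (suc (e + j))             ∎))
    where
    open ≡-Reasoning
    bounded : ∀ {y} → y ∈ high ++ run → InInterval 1 (3 + e + j) y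
    bounded y∈ with ∈-++⁻ high y∈
    ... | inj₂ y∈run  = ≤-trans (s≤s z≤n) (proj₁ (run< y∈run)) ,
                        ≤-trans (proj₂ (run< y∈run)) (s≤s (s≤s (s≤s (≤-trans (m≤m+n e j) (n≤1+n _)))))
    ... | inj₁ y∈high with x , x∈ , refl ← ∈-map⁻ (d +_) y∈high =
      s≤s z≤n , s≤s (s≤s (subst (e + x ≤_) (trans (+-suc e (suc j)) (cong suc (+-suc e j)))
                             (+-monoʳ-≤ e (≤-pred (proj₂ (All.lookup t-bounded x∈))))))

  -- A 213 cannot use the run: the run is increasing and lies below the shifted copy of t.
  no213-snocRun : ¬ Pattern₃ (1 ∷ t) Shape213 → ¬ Pattern₃ (1 ∷ snocRun e t) Shape213
  no213-snocRun no213 P with pattern₃ sub (y<x , x<z) ← Pattern₃-drop-least (All.map (≤-trans (s≤s z≤n)) snocRun≥2) P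
                        with ⊆-++⁻ high sub
  ... | []              , _ , refl , _    , in-run with (x<y ∷ _) ∷ _ ← AllPairs-⊆ in-run (range-increasing 2 d) =
    <-asym x<y y<x
  ... | (_ ∷ [])        , _ , refl , in-high , in-run =
    <-asym x<z (run<high (Sublist.Any-resp-⊆ in-high (here refl)) (Sublist.Any-resp-⊆ in-run (there (here refl))))
  ... | (_ ∷ _ ∷ [])    , _ , refl , in-high , in-run =
    <-asym x<z (run<high (Sublist.Any-resp-⊆ in-high (here refl)) (Sublist.Any-resp-⊆ in-run (here refl)))
  ... | (_ ∷ _ ∷ _ ∷ []) , [] , refl , in-high , _ =
    no213 (Pattern₃-⊆ (1 ∷ʳ ⊆-refl) (Pattern₃-map⁻ (+-monoʳ-< d) t (pattern₃ in-high (y<x , x<z))))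

  module _ {E′ : List (ℕ × ℕ)} (E′-positive : ∀ {p q} → (p , q) ∈ E′ → 1 ≤ p × 1 ≤ q) where

    private
      ψE′ : List (ℕ × ℕ)
      ψE′ = map (Product.map (shift d) (shiftTarget d)) E′

      RunArc : ℕ → ℕ → Set
      RunArc p q = InInterval 2 d p × (q ≡ suc p ⊎ q ≡ 1)

      classify : ∀ {p q} → (p , q) ∈ ψE′ ++ succPairs 1 run → (p , q) ∈ ψE′ ⊎ RunArc p q
      classify a with ∈-++⁻ ψE′ a
      ... | inj₁ a′ = inj₁ a′
      ... | inj₂ a′ = inj₂ (∈-runArcs⁻ 2 d a′)

      image-source : ∀ {p q} → (p , q) ∈ ψE′ → p ≡ 1 ⊎ 3 + e ≤ p
      image-source a with _ , _ , a′ , refl , _ ← preimage (shift d) (shiftTarget d) a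
                     with one-or-more (proj₁ (E′-positive a′))
      ... | inj₁ refl = inj₁ refl
      ... | inj₂ 2≤x  = inj₂ (subst (3 + e ≤_) (sym (shift-≥2 d 2≤x)) (above 2≤x))

      image-target : ∀ {p q} → (p , q) ∈ ψE′ → q ≡ 2 ⊎ 3 + e ≤ q
      image-target a with _ , _ , a′ , _ , refl ← preimage (shift d) (shiftTarget d) a
                     with one-or-more (proj₂ (E′-positive a′))
      ... | inj₁ refl = inj₁ refl
      ... | inj₂ 2≤x  = inj₂ (subst (3 + e ≤_) (sym (shiftTarget-≥2 d 2≤x)) (above 2≤x))

      source≥1 : ∀ {p q} → (p , q) ∈ ψE′ ++ succPairs 1 run → 1 ≤ p
      source≥1 a with classify a
      ... | inj₂ ((2≤p , _) , _) = ≤-trans (s≤s z≤n) 2≤p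
      ... | inj₁ a′ with image-source a′
      ...   | inj₁ refl = ≤-refl
      ...   | inj₂ k≤p  = ≤-trans (s≤s z≤n) k≤p

      target≥1 : ∀ {p q} → (p , q) ∈ ψE′ ++ succPairs 1 run → 1 ≤ q
      target≥1 a with classify a
      ... | inj₂ (_ , inj₁ refl) = s≤s z≤n
      ... | inj₂ (_ , inj₂ refl) = ≤-refl
      ... | inj₁ a′ with image-target a′
      ...   | inj₁ refl = s≤s z≤n
      ...   | inj₂ k≤q  = ≤-trans (s≤s z≤n) k≤q

    -- No arc of the run 2 ↦ 3 ↦ … ↦ e + 2 ↦ 1 occurs in an Ends21 pattern. The third arc cannot be one:
    -- target 1 leaves no room for q₄ < q₃, and target p₃ + 1 would exceed q₂, which is p₂ + 1 or 1 if
    -- the second arc is in the run, while otherwise p₂ ≥ e + 3 > p₃. So p₃ ≥ e + 3, which rules out the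
    -- fourth arc, and q₃ ≥ e + 3, which rules out the first two.
    pull-snocRun : ArcPattern₄ (ψE′ ++ succPairs 1 run) Ends21 → ArcPattern₄ E′ Ends21
    pull-snocRun (arcPattern₄ {p₁} {p₂} {p₃} {p₄} {q₁} {q₂} {q₃} {q₄}
                              a₁ a₂ a₃ a₄ p₁<p₂ p₂<p₃ p₃<p₄ r@(q₃<q₁ , q₃<q₂ , q₄<q₃)) =
      pull (shift-mono d) (Ends21-unmap (shiftTarget-mono e))
           (above-q₃ a₁ q₃<q₁) (above-q₃ a₂ q₃<q₂) a₃′ a₄′ p₁<p₂ p₂<p₃ p₃<p₄ r
      where
      2≤p₂ : 2 ≤ p₂
      2≤p₂ = ≤-<-trans (source≥1 a₁) p₁<p₂

      a₃′ : (p₃ , q₃) ∈ ψE′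
      a₃′ with classify a₃
      ... | inj₁ a = a
      ... | inj₂ (_ , inj₂ refl) = ⊥-elim (<-irrefl refl (<-≤-trans q₄<q₃ (target≥1 a₄)))
      ... | inj₂ ((_ , p₃<k) , inj₁ refl) with classify a₂
      ...   | inj₂ (_ , inj₁ refl) = ⊥-elim (<-asym q₃<q₂ (s≤s p₂<p₃))
      ...   | inj₂ (_ , inj₂ refl) = ⊥-elim (<-irrefl refl (<-≤-trans q₃<q₂ (target≥1 a₃)))
      ...   | inj₁ a₂′ with image-source a₂′
      ...     | inj₁ refl = ⊥-elim (<-irrefl refl 2≤p₂)
      ...     | inj₂ k≤p₂ = ⊥-elim (<-asym p₃<k (≤-<-trans k≤p₂ p₂<p₃))

      k≤p₃ : 3 + e ≤ p₃
      k≤p₃ with image-source a₃′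
      ... | inj₁ refl = ⊥-elim (from-no (2 <? 1) (≤-<-trans 2≤p₂ p₂<p₃))
      ... | inj₂ k≤p₃ = k≤p₃

      a₄′ : (p₄ , q₄) ∈ ψE′
      a₄′ with classify a₄
      ... | inj₁ a                = a
      ... | inj₂ ((_ , p₄<k) , _) = ⊥-elim (<-asym p₄<k (≤-<-trans k≤p₃ p₃<p₄))

      k≤q₃ : 3 + e ≤ q₃
      k≤q₃ with image-target a₃′ | image-target a₄′
      ... | inj₂ k≤q₃ | _        = k≤q₃
      ... | inj₁ refl | inj₁ refl = ⊥-elim (<-irrefl refl q₄<q₃)
      ... | inj₁ refl | inj₂ k≤q₄ = ⊥-elim (<-asym q₄<q₃ (≤-trans (s≤s (s≤s (s≤s z≤n))) k≤q₄))

      above-q₃ : ∀ {p q} → (p , q) ∈ ψE′ ++ succPairs 1 run → q₃ < q → (p , q) ∈ ψE′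
      above-q₃ a q₃<q with classify a
      ... | inj₁ a′                     = a′
      ... | inj₂ (_ , inj₂ refl)        = ⊥-elim (<-irrefl refl (<-≤-trans q₃<q (≤-trans (s≤s z≤n) k≤q₃)))
      ... | inj₂ ((_ , p<k) , inj₁ refl) = ⊥-elim (<-irrefl refl (<-≤-trans q₃<q (≤-trans p<k k≤q₃)))

admissible-snocRun : ∀ {j t} e → Admissible Ends21 (2 + j) t → Admissible Ends21 (3 + e + j) (snocRun e t)
admissible-snocRun {t = t} e (admissible t-perm no213 noArcs) =
  admissible (PermOf-snocRun t-perm) (no213-snocRun no213) noArcs′
  where
  open SnocRun e (PermOf-tail≥2 t-perm)
  noArcs′ : ¬ ArcPattern₄ (arcs (1 ∷ snocRun e t)) Ends21
  noArcs′ A = noArcs (pull-snocRun (λ a → proj₁ (proj₁ (arc-bounded t-perm a)) , proj₁ (proj₂ (arc-bounded t-perm a)))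
    (subst (λ E → ArcPattern₄ E Ends21) (arcs-snocRun e t (PermOf-tail≥2 t-perm)) A))

Tree⇒Admissible : ∀ {n s} → Tree n s → Admissible Ends21 n s
Tree⇒Admissible one        = admissible-one
Tree⇒Admissible (cons T)   = admissible-consTwo (Tree⇒Admissible T)
Tree⇒Admissible (snoc e T) = admissible-snocRun e (Tree⇒Admissible T)

-- Completeness

admissible-consTwo⁻ : ∀ {n s} → Admissible Desc₄ (suc (suc n)) (consTwo s) → Admissible Desc₄ (suc n) s
admissible-consTwo⁻ {n} {s} (admissible c-perm no213 noArcs) = admissible s-perm
  (λ P → no213 (Pattern₃-⊆ (1 ∷ʳ ⊆-refl) (Pattern₃-map⁺ s≤s P)))
  (λ A → noArcs (subst (λ E → ArcPattern₄ E Desc₄) (sym (arcs-consTwo s (PermOf-tail≥2 s-perm)))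
    (push s≤s (Desc₄-map (shift-mono 1)) (λ a → there (∈-map⁺ (Product.map suc (shift 1)) a)) A)))
  where
  s-perm : PermOf (suc n) (1 ∷ s)
  s-perm = PermOf-lift⁻ c-perm

consTwo-pred : ∀ {β} → All (3 ≤_) β → 2 ∷ β ≡ consTwo (map pred β)
consTwo-pred {β} β≥3 = cong (2 ∷_) (begin
  β                    ≡⟨ sym (map-id β) ⟩
  map (λ x → x) β      ≡⟨ map-cong-local (All.map (λ 3≤x → sym (suc-pred _ {{>-nonZero (<-trans z<s 3≤x)}})) β≥3) ⟩
  map (suc ∘ pred) β   ≡⟨ map-∘ β ⟩
  map suc (map pred β) ∎)
  where
  open ≡-Reasoning

admissible-snocRun⁻ : ∀ {j t} e → All (2 ≤_) t →
                      Admissible Desc₄ (3 + e + j) (snocRun e t) → Admissible Desc₄ (2 + j) t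
admissible-snocRun⁻ {j} {t} e t≥2 (admissible (perm (_ ∷ c!) (_ ∷ c-bounded) |c|) no213 noArcs) =
  admissible t-perm
    (λ P → no213 (Pattern₃-⊆ (1 ∷ʳ Sublist.++⁺ʳ run ⊆-refl)
                  (Pattern₃-map⁺ (+-monoʳ-< d) (Pattern₃-drop-least (All.map (≤-trans (s≤s z≤n)) t≥2) P))))
    (λ A → noArcs (subst (λ E → ArcPattern₄ E Desc₄) (sym (arcs-snocRun e t t≥2))
      (push (shift-mono d) (Desc₄-map (shiftTarget-mono e)) (λ a → ∈-++⁺ˡ (∈-map⁺ _ a)) A)))
  where
  open SnocRun e t≥2
  t-perm : PermOf (2 + j) (1 ∷ t)
  t-perm = perm
    (All.map (λ 2≤x 1≡x → <-irrefl 1≡x 2≤x) t≥2 ∷ Unique.map⁻ (AllPairs-⊆ (Sublist.++⁺ʳ run ⊆-refl) c!))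
    ((≤-refl , s≤s (s≤s z≤n)) ∷ All.tabulate bounded)
    (cong suc (+-cancelʳ-≡ d _ _ (begin
      length t + d             ≡⟨ cong₂ _+_ (sym (length-map (d +_) t)) (sym (length-range 2 d)) ⟩
      length high + length run ≡⟨ sym (length-++ high) ⟩
      length (high ++ run)     ≡⟨ suc-injective |c| ⟩
      suc (suc (e + j))        ≡⟨ length-identity j e ⟩
      suc j + d                ∎)))
    where
    open ≡-Reasoning
    length-identity : ∀ j e → suc (suc (e + j)) ≡ suc j + suc e
    length-identity = solve-∀
    bound-identity : ∀ e j → 3 + e + j ≡ suc e + (2 + j)
    bound-identity = solve-∀
    bounded : ∀ {y} → y ∈ t → InInterval 1 (2 + j) y
    bounded {y} y∈ = ≤-trans (s≤s z≤n) (All.lookup t≥2 y∈) , s≤s (+-cancelˡ-≤ d y (2 + j)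
      (subst (d + y ≤_) (bound-identity e j) (≤-pred (proj₂ (All.lookup c-bounded (∈-++⁺ˡ (∈-map⁺ (d +_) y∈)))))))

-- In an admissible cycle form 1 ∷ α ++ 2 ∷ β, avoiding 213 puts β below α, and avoiding 4321 in the arcs
-- makes β an increasing run, hence 3, 4, …, e + 2; so the form is consTwo (if α = []) or snocRun.
module SplitAtTwo {n α β} (adm : Admissible Desc₄ n (α ++ 2 ∷ β)) where

  open Admissible adm

  private
    s! : Unique (α ++ 2 ∷ β)
    s! = AllPairs-⊆ (1 ∷ʳ ⊆-refl) (PermOf.unique isPerm)

    s≥2 : All (2 ≤_) (α ++ 2 ∷ β)
    s≥2 = PermOf-tail≥2 isPerm

    s-bounded : ∀ {x} → x ∈ α ++ 2 ∷ β → InInterval 1 n x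
    s-bounded = All.lookup (PermOf.bounded isPerm) ∘ there

  α≥3 : ∀ {x} → x ∈ α → 3 ≤ x
  α≥3 {x} x∈ = ≤∧≢⇒< (All.lookup s≥2 (∈-++⁺ˡ x∈)) (λ 2≡x → unique-++ α s! (here refl) (subst (_∈ α) (sym 2≡x) x∈))

  β≥3 : ∀ {y} → y ∈ β → 3 ≤ y
  β≥3 {y} y∈ = ≤∧≢⇒< (All.lookup s≥2 (∈-++⁺ʳ α (there y∈))) (λ 2≡y → unique-mid α s! (subst (_∈ β) (sym 2≡y) y∈))

  -- Otherwise x, 2, y would form a 213.
  β<α : ∀ {x y} → x ∈ α → y ∈ β → y < x
  β<α {x} {y} x∈ y∈ with <-cmp x y
  ... | tri> _ _ y<x  = y<x
  ... | tri≈ _ refl _ = ⊥-elim (unique-++ α s! (there y∈) x∈)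
  ... | tri< x<y _ _  = ⊥-elim (avoids213 (pattern₃ (1 ∷ʳ Sublist.++⁺ (from∈ x∈) (refl ∷ from∈ y∈)) (α≥3 x∈ , x<y)))

  module Nonempty {a α′} (α≡ : α ≡ a ∷ α′) where

    -- A peak p′ < y′ > x in 2 ∷ β would give the 4321 formed by the arcs 1 ↦ a, p′ ↦ y′, y′ ↦ x and
    -- (last of α) ↦ 2.
    no-peak : ∀ A {p′ y′ x} Q → 2 ∷ β ≡ A ++ p′ ∷ y′ ∷ x ∷ Q → p′ < y′ → x ≤ y′ → ⊥
    no-peak A {p′} {y′} {x} Q 2β≡′ p′<y′ x≤y′ = avoidsArcs (arcPattern₄
      (subst (λ α → (1 , a) ∈ arcs (1 ∷ α ++ 2 ∷ β)) (sym α≡) (here refl))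
      (arc-at (1 ∷ α ++ A) (x ∷ Q) c≡)
      (arc-at ((1 ∷ α ++ A) ++ [ p′ ]) Q (trans c≡ (sym (++-assoc (1 ∷ α ++ A) [ p′ ] _))))
      (arc-at (1 ∷ P) β (cong (1 ∷_) (trans (cong (_++ 2 ∷ β) (trans α≡ α≡P++l)) (++-assoc P [ l ] (2 ∷ β)))))
      1<p′ p′<y′ (β<α l∈α y′∈β)
      (β<α (subst (a ∈_) (sym α≡) (here refl)) y′∈β , x<y′ , β≥3 x∈β))
      where
      c≡ : 1 ∷ α ++ 2 ∷ β ≡ (1 ∷ α ++ A) ++ p′ ∷ y′ ∷ x ∷ Q
      c≡ = trans (cong (λ L → 1 ∷ α ++ L) 2β≡′) (sym (++-assoc (1 ∷ α) A _))
      y′∈β : y′ ∈ β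
      y′∈β = ∈-after A 2β≡′ (here refl)
      x∈β : x ∈ β
      x∈β = ∈-after A 2β≡′ (there (here refl))
      x<y′ : x < y′
      x<y′ = ≤∧≢⇒< x≤y′ (λ { refl → unique-mid (A ++ [ p′ ]) (subst Unique (trans 2β≡′ (sym (++-assoc A [ p′ ] _)))
                                      (AllPairs-⊆ (Sublist.++⁺ˡ α ⊆-refl) s!)) (here refl) })
      1<p′ : 1 < p′
      1<p′ with subst (p′ ∈_) (sym 2β≡′) (∈-++⁺ʳ A (here refl))
      ... | here refl = ≤-refl
      ... | there p′∈ = ≤-trans (s≤s (s≤s z≤n)) (β≥3 p′∈)
      P : List ℕ
      P = proj₁ (init-last a α′)
      l : ℕ
      l = proj₁ (proj₂ (init-last a α′))
      α≡P++l : a ∷ α′ ≡ P ++ [ l ]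
      α≡P++l = proj₂ (proj₂ (init-last a α′))
      l∈α : l ∈ α
      l∈α = subst (l ∈_) (sym (trans α≡ α≡P++l)) (∈-++⁺ʳ P (here refl))

    β-ascending : AllPairs _<_ β
    β-ascending = peak-free⇒ascending β (All.tabulate β≥3) no-peak

    e : ℕ
    e = length β

    β≡range : β ≡ range 3 e
    β≡range = ascending-closed⇒range 3 β β-ascending (All.tabulate β≥3) closed
      where
      closed : ∀ {y z} → y ∈ β → 3 ≤ z → z < y → z ∈ β
      closed y∈ 3≤z z<y
        with cover isPerm (≤-trans (s≤s z≤n) 3≤z , <-trans z<y (proj₂ (s-bounded (∈-++⁺ʳ α (there y∈)))))
      ... | here refl = ⊥-elim (from-no (3 ≤? 1) 3≤z)
      ... | there z∈ with ∈-++⁻ α z∈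
      ...   | inj₁ z∈α         = ⊥-elim (<-asym z<y (β<α z∈α y∈))
      ...   | inj₂ (here refl) = ⊥-elim (from-no (3 ≤? 2) 3≤z)
      ...   | inj₂ (there z∈β) = z∈β

    -- Every value between 3 and e + 2 is taken by the run β.
    α-high : ∀ {x} → x ∈ α → 3 + e ≤ x
    α-high {x} x∈ with 3 + e ≤? x
    ... | yes 3+e≤x = 3+e≤x
    ... | no  3+e≰x = ⊥-elim (unique-++ α s! (there (subst (x ∈_) (sym β≡range) (∈-range⁺ (α≥3 x∈ , ≰⇒> 3+e≰x)))) x∈)

    t : List ℕ
    t = map (_∸ suc e) α

    t≥2 : All (2 ≤_) t
    t≥2 = All-map⁺ (All.tabulate (λ x∈ → m+n≤o⇒m≤o∸n 2 (α-high x∈)))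

    α≡snocRun : α ++ 2 ∷ β ≡ snocRun e t
    α≡snocRun = cong₂ _++_ α≡high (cong (2 ∷_) β≡range)
      where
      α≡high : α ≡ map (suc e +_) t
      α≡high = begin
        α                                ≡⟨ sym (map-id α) ⟩
        map (λ x → x) α                  ≡⟨ map-cong-local (All.tabulate (λ x∈ → sym (m+[n∸m]≡n (e+1≤ x∈)))) ⟩
        map (λ x → suc e + (x ∸ suc e)) α ≡⟨ map-∘ α ⟩
        map (suc e +_) t                 ∎
        where
        open ≡-Reasoning
        e+1≤ : ∀ {x} → x ∈ α → suc e ≤ x
        e+1≤ x∈ = ≤-trans (n≤1+n _) (≤-trans (n≤1+n _) (α-high x∈))

    n≡ : n ≡ 3 + e + length α′
    n≡ = begin
      n                                 ≡⟨ sym (PermOf.length≡ isPerm) ⟩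
      suc (length (α ++ 2 ∷ β))         ≡⟨ cong (λ α → suc (length (α ++ 2 ∷ β))) α≡ ⟩
      suc (suc (length (α′ ++ 2 ∷ β)))  ≡⟨ cong (suc ∘ suc) (length-++ α′) ⟩
      suc (suc (length α′ + suc e))     ≡⟨ arithmetic (length α′) e ⟩
      3 + e + length α′                 ∎
      where
      open ≡-Reasoning
      arithmetic : ∀ j e → suc (suc (j + suc e)) ≡ 3 + e + j
      arithmetic = solve-∀

two∈ : ∀ {n x s} → PermOf n (1 ∷ x ∷ s) → 2 ∈ x ∷ s
two∈ c-perm@(perm _ _ |c|) with cover c-perm (s≤s z≤n , subst (λ k → 2 < suc k) |c| (s≤s (s≤s (s≤s z≤n))))
... | there 2∈ = 2∈

Admissible⇒Tree : ∀ n {s} → Admissible Desc₄ n s → Tree n s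
Admissible⇒Tree = <-rec _ step
  where
  step : ∀ n → (∀ {m} → m < n → ∀ {s} → Admissible Desc₄ m s → Tree m s) → ∀ {s} → Admissible Desc₄ n s → Tree n s
  step 0             _   (admissible (perm _ _ ()) _ _)
  step 1             _   {[]}    _                                = one
  step 1             _   {_ ∷ _} (admissible (perm _ _ ()) _ _)
  step (suc (suc m)) _   {[]}    (admissible (perm _ _ ()) _ _)
  step (suc (suc m)) rec {x ∷ s} adm with α , β , s≡ ← ∈-∃++ (two∈ (Admissible.isPerm adm)) =
    subst (Tree _) (sym s≡) (split α β (subst (Admissible Desc₄ _) s≡ adm))
    where
    split : ∀ α β → Admissible Desc₄ (suc (suc m)) (α ++ 2 ∷ β) → Tree (suc (suc m)) (α ++ 2 ∷ β)
    split [] β adm′ =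
      subst (Tree _) (sym β≡) (cons (rec ≤-refl (admissible-consTwo⁻ (subst (Admissible Desc₄ _) β≡ adm′))))
      where
      β≡ : 2 ∷ β ≡ consTwo (map pred β)
      β≡ = consTwo-pred (All.tabulate (SplitAtTwo.β≥3 {α = []} adm′))
    split (a ∷ α′) β adm′ = subst₂ Tree (sym n≡) (sym α≡snocRun)
      (snoc e (rec (subst (2 + length α′ <_) (sym n≡) smaller)
                   (admissible-snocRun⁻ e t≥2 (subst₂ (Admissible Desc₄) n≡ α≡snocRun adm′))))
      where
      open SplitAtTwo {α = a ∷ α′} adm′
      open Nonempty refl
      smaller : 2 + length α′ < 3 + e + length α′
      smaller = s≤s (s≤s (s≤s (m≤n+m (length α′) e)))

-- gen n lists the trees of size n, and tails n the pairs (e , t) for which snoc e t has size n;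
-- each tree of size n + 1 comes from one of size n by cons or from a tail by snoc, and each tail of
-- size n + 1 is (0 , t) for t of size n or extends a tail of size n.
gen : ℕ → List (List ℕ)
tails : ℕ → List (ℕ × List ℕ)

gen 0             = []
gen 1             = [] ∷ []
gen (suc (suc m)) = map consTwo (gen (suc m)) ++ map (Product.uncurry snocRun) (tails (suc (suc m)))

pair₀ : List ℕ → ℕ × List ℕ
pair₀ t = 0 , t

tails 0                   = []
tails 1                   = []
tails 2                   = []
tails (suc (suc (suc m))) = map pair₀ (gen (suc (suc m))) ++ map (Product.map₁ suc) (tails (suc (suc m)))

enumeration-sound : ∀ m → (∀ {s} → s ∈ gen (suc m) → Tree (suc m) s) ×
                          (∀ {e t} → (e , t) ∈ tails (suc (suc m)) → ∃ λ j → Tree (2 + j) t × suc (suc m) ≡ 3 + e + j)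
enumeration-sound zero    = (λ { (here refl) → one }) , λ ()
enumeration-sound (suc m) = gen-sound , tails-sound
  where
  gen-sound : ∀ {s} → s ∈ gen (2 + m) → Tree (2 + m) s
  gen-sound s∈ with ∈-++⁻ (map consTwo (gen (suc m))) s∈
  ... | inj₁ s∈cons with s′ , s′∈ , refl ← ∈-map⁻ consTwo s∈cons = cons (proj₁ (enumeration-sound m) s′∈)
  ... | inj₂ s∈snoc with (e , t) , et∈ , refl ← ∈-map⁻ (Product.uncurry snocRun) s∈snoc
                    with j , T , n≡ ← proj₂ (enumeration-sound m) et∈ =
    subst (λ n → Tree n (snocRun e t)) (sym n≡) (snoc e T)
  tails-sound : ∀ {e t} → (e , t) ∈ tails (3 + m) → ∃ λ j → Tree (2 + j) t × 3 + m ≡ 3 + e + j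
  tails-sound et∈ with ∈-++⁻ (map pair₀ (gen (2 + m))) et∈
  ... | inj₁ et∈₀ with t , t∈ , refl ← ∈-map⁻ pair₀ et∈₀ = m , gen-sound t∈ , refl
  ... | inj₂ et∈₊ with (e , t) , et′∈ , refl ← ∈-map⁻ (Product.map₁ suc) et∈₊
                  with j , T , n≡ ← proj₂ (enumeration-sound m) et′∈ = j , T , cong suc n≡

gen-sound : ∀ {m s} → s ∈ gen (suc m) → Tree (suc m) s
gen-sound {m} = proj₁ (enumeration-sound m)

gen-complete : ∀ {n s} → Tree n s → s ∈ gen n
tails-complete : ∀ {j t} e → Tree (2 + j) t → (e , t) ∈ tails (3 + e + j)

gen-complete one        = here refl
gen-complete (cons T)   = ∈-++⁺ˡ (∈-map⁺ consTwo (gen-complete T))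
gen-complete (snoc e T) = ∈-++⁺ʳ _ (∈-map⁺ (Product.uncurry snocRun) (tails-complete e T))

tails-complete zero    T = ∈-++⁺ˡ (∈-map⁺ pair₀ (gen-complete T))
tails-complete (suc e) T = ∈-++⁺ʳ _ (∈-map⁺ (Product.map₁ suc) (tails-complete e T))

length-gen : ∀ m → length (gen (2 + m)) ≡ F (1 + 2 * m) × length (tails (2 + m)) ≡ F (2 * m)
length-gen zero    = refl , refl
length-gen (suc m) with |gen| , |tails| ← length-gen m = |gen′| , |tails′|
  where
  open ≡-Reasoning
  2*[1+m] : 2 * suc m ≡ 2 + 2 * m
  2*[1+m] = *-suc 2 m
  |tails′| : length (tails (3 + m)) ≡ F (2 * suc m)
  |tails′| = begin
    length (map pair₀ (gen (2 + m)) ++ map (Product.map₁ suc) (tails (2 + m)))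
      ≡⟨ length-++ (map pair₀ (gen (2 + m))) ⟩
    length (map pair₀ (gen (2 + m))) + length (map (Product.map₁ suc) (tails (2 + m)))
      ≡⟨ cong₂ _+_ (trans (length-map pair₀ (gen (2 + m))) |gen|)
                   (trans (length-map (Product.map₁ suc) (tails (2 + m))) |tails|) ⟩
    F (1 + 2 * m) + F (2 * m)
      ≡⟨ cong F (sym 2*[1+m]) ⟩
    F (2 * suc m) ∎
  |gen′| : length (gen (3 + m)) ≡ F (1 + 2 * suc m)
  |gen′| = begin
    length (map consTwo (gen (2 + m)) ++ map (Product.uncurry snocRun) (tails (3 + m)))
      ≡⟨ length-++ (map consTwo (gen (2 + m))) ⟩
    length (map consTwo (gen (2 + m))) + length (map (Product.uncurry snocRun) (tails (3 + m)))
      ≡⟨ cong₂ _+_ (trans (length-map consTwo (gen (2 + m))) |gen|)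
                   (trans (length-map (Product.uncurry snocRun) (tails (3 + m))) |tails′|) ⟩
    F (1 + 2 * m) + F (2 * suc m)
      ≡⟨ cong (λ k → F (1 + 2 * m) + F k) 2*[1+m] ⟩
    F (1 + 2 * m) + F (2 + 2 * m)
      ≡⟨ +-comm (F (1 + 2 * m)) _ ⟩
    F (3 + 2 * m)
      ≡⟨ cong (λ k → F (1 + k)) (sym 2*[1+m]) ⟩
    F (1 + 2 * suc m) ∎

two∉shifted : ∀ e {t} → All (2 ≤_) t → 2 ∉ map (suc e +_) t
two∉shifted e t≥2 2∈ with x , x∈ , 2≡ ← ∈-map⁻ (suc e +_) 2∈ =
  <-irrefl 2≡ (s≤s (≤-trans (All.lookup t≥2 x∈) (m≤n+m x e)))

-- The 2 in snocRun e t separates the shifted t from the run, whose length is e + 1.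
snocRun-injective : ∀ {e e′ t t′} → All (2 ≤_) t → All (2 ≤_) t′ → snocRun e t ≡ snocRun e′ t′ → (e , t) ≡ (e′ , t′)
snocRun-injective {e} {e′} {t} {t′} t≥2 t′≥2 eq
  with high≡ , run≡ ← ++-∷-cancel (map (suc e +_) t) (map (suc e′ +_) t′) (two∉shifted e t≥2) (two∉shifted e′ t′≥2) eq
  with refl ← trans (sym (length-range 3 e)) (trans (cong length run≡) (length-range 3 e′)) =
  cong (e ,_) (map-injective (+-cancelˡ-≡ (suc e) _ _) high≡)

snocRun≢consTwo : ∀ {e t s} → All (2 ≤_) t → t ≢ [] → snocRun e t ≢ consTwo s
snocRun≢consTwo {t = []}    _           t≢[] _  = t≢[] refl
snocRun≢consTwo {e} {x ∷ t} (2≤x ∷ _) _    eq =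
  <-irrefl (sym (∷-injectiveˡ eq)) (s≤s (≤-trans 2≤x (m≤n+m x e)))

tails-members : ∀ m {e t} → (e , t) ∈ tails (suc (suc m)) → All (2 ≤_) t × t ≢ []
tails-members m et∈ with j , T , _ ← proj₂ (enumeration-sound m) et∈ =
  PermOf-tail≥2 (Admissible.isPerm (Tree⇒Admissible T)) , nonempty (Admissible.isPerm (Tree⇒Admissible T))
  where
  nonempty : ∀ {j t} → PermOf (2 + j) (1 ∷ t) → t ≢ []
  nonempty (perm _ _ ()) refl

unique-enumeration : ∀ m → Unique (gen (suc m)) × Unique (tails (suc (suc m)))
unique-enumeration zero    = [] ∷ [] , []
unique-enumeration (suc m) = gen! , tails!
  where
  consTwo-injective : ∀ {s s′} → consTwo s ≡ consTwo s′ → s ≡ s′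
  consTwo-injective eq = map-injective suc-injective (∷-injectiveʳ eq)
  gen! : Unique (gen (2 + m))
  gen! = Unique.++⁺ (Unique.map⁺ consTwo-injective (proj₁ (unique-enumeration m)))
    (unique-map⁺ (λ et∈ et′∈ → snocRun-injective (proj₁ (tails-members m et∈)) (proj₁ (tails-members m et′∈)))
                 (proj₂ (unique-enumeration m)))
    (λ (v∈cons , v∈snoc) → disjoint v∈cons v∈snoc)
    where
    disjoint : ∀ {v} → v ∈ map consTwo (gen (suc m)) → v ∈ map (Product.uncurry snocRun) (tails (2 + m)) → ⊥
    disjoint v∈cons v∈snoc with _ , _ , refl ← ∈-map⁻ consTwo v∈cons
                           with (e , t) , et∈ , eq ← ∈-map⁻ (Product.uncurry snocRun) v∈snoc =
      snocRun≢consTwo (proj₁ (tails-members m et∈)) (proj₂ (tails-members m et∈)) (sym eq)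
  tails! : Unique (tails (3 + m))
  tails! = Unique.++⁺ (Unique.map⁺ (cong proj₂) gen!)
    (Unique.map⁺ (λ eq → cong₂ _,_ (suc-injective (cong proj₁ eq)) (cong proj₂ eq)) (proj₂ (unique-enumeration m)))
    (λ (v∈₀ , v∈₊) → disjoint v∈₀ v∈₊)
    where
    disjoint : ∀ {v} → v ∈ map pair₀ (gen (2 + m)) → v ∈ map (Product.map₁ suc) (tails (2 + m)) → ⊥
    disjoint v∈₀ v∈₊ with _ , _ , refl ← ∈-map⁻ pair₀ v∈₀ with _ , _ , () ← ∈-map⁻ (Product.map₁ suc) v∈₊

-- The patterns τ and τ⁻¹

posOf-++ : ∀ x (A : List ℕ) B → x ∉ A → posOf x (A ++ B) ≡ length A + posOf x B
posOf-++ x []      B _   = refl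
posOf-++ x (a ∷ A) B x∉ with x ≟ a
... | yes refl = ⊥-elim (x∉ (here refl))
... | no  _    = cong suc (posOf-++ x A B (x∉ ∘ there))

posOf-head : ∀ x L → posOf x (x ∷ L) ≡ 1
posOf-head x L with x ≟ x
... | yes _  = refl
... | no x≢x = ⊥-elim (x≢x refl)

module Tau {k a b ρ′} (τ-perm : IsPerm k (a ∷ b ∷ ρ′ ++ 2 ∷ 1 ∷ [])) where

  τ : List ℕ
  τ = a ∷ b ∷ ρ′ ++ 2 ∷ 1 ∷ []

  K : ℕ
  K = length ρ′

  private
    open PermOf (IsPerm⇒PermOf τ-perm)

    a∉ : a ∉ b ∷ ρ′ ++ 2 ∷ 1 ∷ []
    a∉ a∈ with a≢ ∷ _ ← unique = All.lookup a≢ a∈ refl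

    b∉ : b ∉ ρ′ ++ 2 ∷ 1 ∷ []
    b∉ b∈ with _ ∷ b≢ ∷ _ ← unique = All.lookup b≢ b∈ refl

    ≥3 : ∀ {x} → InInterval 1 k x → x ∉ ρ′ ++ 2 ∷ 1 ∷ [] → 3 ≤ x
    ≥3 {x} (1≤x , _) x∉ with one-or-more 1≤x
    ... | inj₁ refl = ⊥-elim (x∉ (∈-++⁺ʳ ρ′ (there (here refl))))
    ... | inj₂ 2≤x  = ≤∧≢⇒< 2≤x (λ { refl → x∉ (∈-++⁺ʳ ρ′ (here refl)) })

  a≥3 : 3 ≤ a
  a≥3 = ≥3 (All.head bounded) (a∉ ∘ there)

  b≥3 : 3 ≤ b
  b≥3 = ≥3 (All.head (All.tail bounded)) b∉

  length-τ : length τ ≡ 2 + (K + 2)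
  length-τ = cong (suc ∘ suc) (length-++ ρ′)

  -- τ ends with 2 1 after a, b ≥ 3, so its entries at positions 0, 1, K + 2, K + 3 form 3421 or 4321.
  contains-τ⇒Ends21 : ∀ {w} → Contains w τ → Pattern₄ w Ends21
  contains-τ⇒Ends21 {w} (v , v⊆w , |v| , iso) = pattern₄
    (⊆-trans (subsequence-at 0 v (Linked⇒AllPairs <-trans (z<s ∷ s<s z<s ∷ K+2<K+3 ∷ [-])) positions) v⊆w)
    ( order 0 (2 + (K + 0)) z<s K+2<len (subst₂ _<_ (sym at₂) refl a≥3)
    , order 1 (2 + (K + 0)) (s<s z<s) K+2<len (subst₂ _<_ (sym at₂) refl b≥3)
    , order (2 + (K + 0)) (2 + (K + 1)) K+2<K+3 K+3<len (subst₂ _<_ (sym at₁) (sym at₂) ≤-refl))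
    where
    K+2<K+3 : 2 + (K + 0) < 2 + (K + 1)
    K+2<K+3 = s<s (s<s (+-monoʳ-< K z<s))
    K+2<len : 2 + (K + 0) < 2 + (K + 2)
    K+2<len = s<s (s<s (+-monoʳ-< K z<s))
    K+3<len : 2 + (K + 1) < 2 + (K + 2)
    K+3<len = s<s (s<s (+-monoʳ-< K (s<s z<s)))
    bound : ∀ {i} → i < 2 + (K + 2) → InInterval 0 (length v) i
    bound {i} i< = z≤n , subst (i <_) (sym (trans |v| length-τ)) i<
    positions : All (InInterval 0 (length v)) (0 ∷ 1 ∷ 2 + (K + 0) ∷ 2 + (K + 1) ∷ [])
    positions = bound z<s ∷ bound (s<s z<s) ∷ bound K+2<len ∷ bound K+3<len ∷ []
    order : ∀ s t → s < t → t < 2 + (K + 2) → at τ t < at τ s → at v t < at v s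
    order s t s<t t< = Equivalence.from (iso s t s<t (subst (t <_) (sym length-τ) t<))
    at₂ : at τ (2 + (K + 0)) ≡ 2
    at₂ = at-++ ρ′ (2 ∷ 1 ∷ []) 0
    at₁ : at τ (2 + (K + 1)) ≡ 1
    at₁ = at-++ ρ′ (2 ∷ 1 ∷ []) 1

  private
    σ : List ℕ
    σ = inverse k τ

    in-range : ∀ {x} → x ∈ τ → InInterval 1 k x
    in-range = All.lookup bounded

    app-σ : ∀ {j} → j ∈ τ → app σ j ≡ posOf j τ
    app-σ j∈ = app-map-oneTo k (λ j → posOf j τ) (in-range j∈)

    posOf-1 : posOf 1 τ ≡ 2 + K + 2
    posOf-1 = posOf-++ 1 (a ∷ b ∷ ρ′) (2 ∷ 1 ∷ []) (unique-++ (a ∷ b ∷ ρ′) unique (there (here refl)))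

    posOf-2 : posOf 2 τ ≡ 2 + K + 1
    posOf-2 = posOf-++ 2 (a ∷ b ∷ ρ′) (2 ∷ 1 ∷ []) (unique-++ (a ∷ b ∷ ρ′) unique (here refl))

    posOf-b : posOf b τ ≡ 2
    posOf-b with b ≟ a
    ... | yes refl = ⊥-elim (a∉ (here refl))
    ... | no  _    = cong suc (posOf-head b _)

    1∈τ : 1 ∈ τ
    1∈τ = there (there (∈-++⁺ʳ ρ′ (there (here refl))))

    2∈τ : 2 ∈ τ
    2∈τ = there (there (∈-++⁺ʳ ρ′ (here refl)))

    length-σ : length σ ≡ k
    length-σ = trans (length-map _ (oneTo k)) (length-oneTo k)

    starts43-at : ∀ {v} → OrderIso v σ → ∀ {x y} → x ∈ τ → y ∈ τ → 2 < x → x < y →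
                  app σ x < 2 + K + 1 → app σ y < 2 + K + 1 → Pattern₄ v Starts43
    starts43-at {v} iso {x} {y} x∈ y∈ 2<x x<y σx< σy< = pattern₄
      (subsequence-at 1 v (Linked⇒AllPairs <-trans (s<s z<s ∷ 2<x ∷ x<y ∷ [-]))
        (position 1∈τ ∷ position 2∈τ ∷ position x∈ ∷ position y∈ ∷ []))
      ( order 1 2 (s<s z<s) 1∈τ 2∈τ
          (subst₂ _<_ (sym (trans (app-σ 2∈τ) posOf-2)) (sym (trans (app-σ 1∈τ) posOf-1)) (+-monoʳ-< (2 + K) ≤-refl))
      , order 2 x 2<x 2∈τ x∈ (subst (app σ x <_) (sym (trans (app-σ 2∈τ) posOf-2)) σx<)
      , order 2 y (<-trans 2<x x<y) 2∈τ y∈ (subst (app σ y <_) (sym (trans (app-σ 2∈τ) posOf-2)) σy<))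
      where
      position : ∀ {j} → j ∈ τ → InInterval 1 (length v) j
      position j∈ = subst (λ m → InInterval 1 m _) (trans (sym length-σ) (sym (proj₁ iso))) (in-range j∈)
      order : ∀ i j → i < j → i ∈ τ → j ∈ τ → app σ j < app σ i → app v j < app v i
      order zero    _       _         i∈ _  = ⊥-elim (<-irrefl refl (proj₁ (in-range i∈)))
      order (suc i) (suc j) (s≤s i<j) _  j∈ =
        Equivalence.from (proj₂ iso i j i<j (subst (j <_) (sym length-σ) (≤-pred (proj₂ (in-range j∈)))))

  -- In τ⁻¹ the values 1 and 2 sit at positions a and b, after the two largest values at positions 1 and 2.
  contains-τ⁻¹⇒Starts43 : ∀ {w} → Contains w σ → Pattern₄ w Starts43
  contains-τ⁻¹⇒Starts43 {w} (v , v⊆w , iso) = Pattern₄-⊆ v⊆w (case (<-cmp a b))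
    where
    σa< : app σ a < 2 + K + 1
    σa< = subst (_< _) (sym (trans (app-σ (here refl)) (posOf-head a _))) (s<s z<s)
    σb< : app σ b < 2 + K + 1
    σb< = subst (_< _) (sym (trans (app-σ (there (here refl))) posOf-b)) (s≤s (s≤s (m≤n+m 1 K)))
    case : Tri (a < b) (a ≡ b) (b < a) → Pattern₄ v Starts43
    case (tri< a<b _ _)  = starts43-at iso (here refl) (there (here refl)) a≥3 a<b σa< σb<
    case (tri> _ _ b<a)  = starts43-at iso (there (here refl)) (here refl) b≥3 b<a σb< σa<
    case (tri≈ _ refl _) = ⊥-elim (a∉ (here refl))

hasCard-image : ∀ {P : List ℕ → Set} (G : List (List ℕ)) (f : List ℕ → List ℕ) → Unique G → InjectiveOn f G →
                (∀ {s} → s ∈ G → P (f s)) → (∀ {w} → P w → ∃ λ s → s ∈ G × w ≡ f s) → HasCard P (length G)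
hasCard-image {P} G f G! f-injective sound complete =
  map f G , unique-map⁺ f-injective G! , (λ w → mk⇔ (image⇒P w) (P⇒image w)) , length-map f G
  where
  image⇒P : ∀ w → w ∈ map f G → P w
  image⇒P w w∈ with s , s∈ , refl ← ∈-map⁻ f w∈ = sound s∈
  P⇒image : ∀ w → P w → w ∈ map f G
  P⇒image w Pw with s , s∈ , refl ← complete {w} Pw = ∈-map⁺ f s∈

fromCycle-injective : ∀ {n s s′} → PermOf n (1 ∷ s) → PermOf n (1 ∷ s′) →
                      fromCycle n (1 ∷ s) ≡ fromCycle n (1 ∷ s′) → s ≡ s′
fromCycle-injective {n} c-perm c′-perm eq = ∷-injectiveʳ (begin
  _                             ≡⟨ sym (FromCycle.cycleForm-fromCycle c-perm) ⟩
  cycleForm n (fromCycle n _)   ≡⟨ cong (cycleForm n) eq ⟩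
  cycleForm n (fromCycle n _)   ≡⟨ FromCycle.cycleForm-fromCycle c′-perm ⟩
  _                             ∎)
  where open ≡-Reasoning

module Enumeration {k a b ρ′} (τ-perm : IsPerm k (a ∷ b ∷ ρ′ ++ 2 ∷ 1 ∷ [])) (m : ℕ) where

  open Tau τ-perm

  n : ℕ
  n = 2 + m

  𝒜₁ 𝒜₂ : List ℕ → Set
  𝒜₁ = InA n (τ ∷ (4 ∷ 3 ∷ 2 ∷ 1 ∷ []) ∷ []) (2 ∷ 1 ∷ 3 ∷ [])
  𝒜₂ = InA n (inverse k τ ∷ (4 ∷ 3 ∷ 2 ∷ 1 ∷ []) ∷ []) (3 ∷ 1 ∷ 2 ∷ [])

  tree⇒𝒜₁ : ∀ {s} → Tree n s → 𝒜₁ (fromCycle n (1 ∷ s))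
  tree⇒𝒜₁ T =
      PermOf⇒IsPerm fromCycle-perm
    , subst Unique (sym cycleForm-fromCycle) (PermOf.unique isPerm)
    , (avoidsArcs ∘ pattern⇒arcPattern ∘ contains-τ⇒Ends21)
    ∷ (avoidsArcs ∘ pattern⇒arcPattern ∘ Pattern₄-Desc₄⇒Ends21 ∘ Equivalence.to contains-4321⇔) ∷ []
    , avoids213 ∘ Equivalence.to (contains-213⇔ (PermOf.unique isPerm))
      ∘ subst (λ c → Contains c (2 ∷ 1 ∷ 3 ∷ [])) cycleForm-fromCycle
    where
    open Admissible (Tree⇒Admissible T)
    open FromCycle isPerm

  𝒜₁⇒tree : ∀ {w} → 𝒜₁ w → ∃ λ s → Tree n s × w ≡ fromCycle n (1 ∷ s)
  𝒜₁⇒tree {w} (w-perm , w-cyclic , _ ∷ avoids4321 ∷ [] , avoids213) =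
    _ , Admissible⇒Tree n adm , sym fromCycle-cycleForm
    where
    open CycleForm w-perm w-cyclic
    adm : Admissible Desc₄ n (orbitFrom w (suc m) (app w 1))
    adm = admissible cycleForm-perm
      (avoids213 ∘ Equivalence.from (contains-213⇔ w-cyclic))
      (avoids4321 ∘ Equivalence.from contains-4321⇔ ∘ subst (λ w → Pattern₄ w Desc₄) fromCycle-cycleForm
                  ∘ FromCycle.arcPattern⇒pattern cycleForm-perm)

  tree⇒𝒜₂ : ∀ {s} → Tree n s → 𝒜₂ (fromCycle n (1 ∷ reverse s))
  tree⇒𝒜₂ {s} T =
      PermOf⇒IsPerm fromCycle-perm
    , subst Unique (sym cycleForm-fromCycle) (PermOf.unique reversed)
    , (avoidsArcs ∘ Starts43-reverse s (PermOf.unique isPerm) ∘ pattern⇒arcPattern ∘ contains-τ⁻¹⇒Starts43)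
    ∷ (avoidsArcs ∘ Desc₄⇒Ends21-arcs ∘ Desc₄-reverse s ∘ pattern⇒arcPattern ∘ Equivalence.to contains-4321⇔) ∷ []
    , avoids213 ∘ Pattern₃-⊆ (1 ∷ʳ ⊆-refl) ∘ Pattern₃-reverse ∘ Pattern₃-drop-one
      ∘ Equivalence.to (contains-312⇔ (PermOf.unique reversed))
      ∘ subst (λ c → Contains c (3 ∷ 1 ∷ 2 ∷ [])) cycleForm-fromCycle
    where
    open Admissible (Tree⇒Admissible T)
    reversed : PermOf n (1 ∷ reverse s)
    reversed = PermOf-reverse isPerm
    open FromCycle reversed

  𝒜₂⇒tree : ∀ {w} → 𝒜₂ w → ∃ λ s → Tree n s × w ≡ fromCycle n (1 ∷ reverse s)
  𝒜₂⇒tree {w} (w-perm , w-cyclic , _ ∷ avoids4321 ∷ [] , avoids312) =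
    reverse r , Admissible⇒Tree n adm ,
    trans (sym fromCycle-cycleForm) (cong (λ r → fromCycle n (1 ∷ r)) (sym (reverse-involutive r)))
    where
    open CycleForm w-perm w-cyclic
    r : List ℕ
    r = orbitFrom w (suc m) (app w 1)
    adm : Admissible Desc₄ n (reverse r)
    adm = admissible (PermOf-reverse cycleForm-perm)
      (avoids312 ∘ Equivalence.from (contains-312⇔ w-cyclic) ∘ Pattern₃-⊆ (1 ∷ʳ ⊆-refl) ∘ Pattern₃-reverse
                 ∘ Pattern₃-drop-least (All.map (≤-trans (s≤s z≤n)) (PermOf-tail≥2 (PermOf-reverse cycleForm-perm))))
      (avoids4321 ∘ Equivalence.from contains-4321⇔ ∘ subst (λ w → Pattern₄ w Desc₄) fromCycle-cycleForm
                  ∘ FromCycle.arcPattern⇒pattern cycleForm-perm ∘ Desc₄-reverse r)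

  private
    tree-perm : ∀ {s} → s ∈ gen n → PermOf n (1 ∷ s)
    tree-perm s∈ = Admissible.isPerm (Tree⇒Admissible (gen-sound s∈))

  count₁ : HasCard 𝒜₁ (length (gen n))
  count₁ = hasCard-image (gen n) (λ s → fromCycle n (1 ∷ s)) (proj₁ (unique-enumeration (suc m)))
    (λ s∈ s′∈ → fromCycle-injective (tree-perm s∈) (tree-perm s′∈))
    (tree⇒𝒜₁ ∘ gen-sound)
    (λ w∈ → let s , T , w≡ = 𝒜₁⇒tree w∈ in s , gen-complete T , w≡)

  count₂ : HasCard 𝒜₂ (length (gen n))
  count₂ = hasCard-image (gen n) (λ s → fromCycle n (1 ∷ reverse s)) (proj₁ (unique-enumeration (suc m)))
    (λ s∈ s′∈ → reverse-injective
                ∘ fromCycle-injective (PermOf-reverse (tree-perm s∈)) (PermOf-reverse (tree-perm s′∈)))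
    (tree⇒𝒜₂ ∘ gen-sound)
    (λ w∈ → let s , T , w≡ = 𝒜₂⇒tree w∈ in s , gen-complete T , w≡)

theorem3p4 : ∀ (k : ℕ) → 4 ≤ k → (τ : List ℕ) → IsPerm k τ →
    (∃ λ ρ → τ ≡ ρ ++ (2 ∷ 1 ∷ [])) →
    ∀ (n : ℕ) → 2 ≤ n →
    HasCard (InA n (τ ∷ (4 ∷ 3 ∷ 2 ∷ 1 ∷ []) ∷ []) (2 ∷ 1 ∷ 3 ∷ [])) (F (2 * n ∸ 3)) ×
    HasCard (InA n (inverse k τ ∷ (4 ∷ 3 ∷ 2 ∷ 1 ∷ []) ∷ []) (3 ∷ 1 ∷ 2 ∷ [])) (F (2 * n ∸ 3))
theorem3p4 k 4≤k _ τ-perm ([] , refl) _ _ =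
  ⊥-elim (from-no (4 ≤? 2) (subst (4 ≤_) (sym (PermOf.length≡ (IsPerm⇒PermOf τ-perm))) 4≤k))
theorem3p4 k 4≤k _ τ-perm (a ∷ [] , refl) _ _ =
  ⊥-elim (from-no (4 ≤? 3) (subst (4 ≤_) (sym (PermOf.length≡ (IsPerm⇒PermOf τ-perm))) 4≤k))
theorem3p4 k 4≤k _ τ-perm (a ∷ b ∷ ρ′ , refl) 1 (s≤s ())
theorem3p4 k 4≤k _ τ-perm (a ∷ b ∷ ρ′ , refl) (suc (suc m)) _ =
  subst (HasCard _) count count₁ , subst (HasCard _) count count₂
  where
  open Enumeration τ-perm m
  2*[2+m] : ∀ m → 2 * (2 + m) ≡ 3 + (1 + 2 * m)
  2*[2+m] = solve-∀
  count : length (gen (2 + m)) ≡ F (2 * (2 + m) ∸ 3)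
  count = trans (proj₁ (length-gen m)) (cong (F ∘ (_∸ 3)) (sym (2*[2+m] m)))
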